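{- Let $\mathbb{F}_q$ be a finite field, $\lambda_0\in\mathbb{F}_q^\times$, and $(d_1,\ldots,d_r)$ a partition of $h$ with $d_1\le\cdots\le d_r$. Let $I$ be the set of tuples $(P_1,\ldots,P_r)$ of monic irreducible polynomials in $\mathbb{F}_q[X]$ with $\deg P_i=d_i$ such that $P_1\cdots P_r\cdot\widetilde{P_1}^{\lambda_0}\cdots\widetilde{P_r}^{\lambda_0}$ is separable, and let $H(P_1,\ldots,P_r)=P_1\cdots P_r\cdot\widetilde{P_1}^{\lambda_0}\cdots\widetilde{P_r}^{\lambda_0}$. Then for every $\chi$ in the image $H(I)$, \[ \#H^{ -1}(\chi)=2^r\cdot\prod_{k=1}^h\#\{j: d_j=k\}!. \]
   Context: For a monic $P$ of degree $r$ with constant coefficient $a_0\neq0$ and $\lambda_0\in\mathbb{F}_q^\times$, the $\lambda_0$-reciprocal polynomial is $\widetilde{P}^{\lambda_0}(X)=\frac1{a_0}X^rP(\lambda_0/X)$. Separable means having only simple roots over an algebraic closure. -}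

module Defs where

open import Level using (0ℓ)
open import Data.Nat as ℕ using (ℕ; zero; suc; _≤_; _∸_)
open import Data.Nat.ListAction using (sum; product)
open import Data.List as L using (List; []; _∷_; _++_; map; upTo; foldr; length)
open import Data.List.Relation.Unary.All using (All; []; _∷_)
open import Data.List.Relation.Unary.Linked using (Linked)
open import Data.List.Relation.Unary.Unique.Propositional using (Unique)
open import Data.List.Membership.Propositional using (_∈_)
open import Data.Vec as V using (Vec)
open import Data.Product using (Σ; _×_; ∃)
open import Data.Sum using (_⊎_)
open import Relation.Nullary using (¬_)
open import Relation.Binary.PropositionalEquality using (_≡_)
open import Relation.Binary.Definitions using (DecidableEquality)
open import Algebra.Structures using (IsCommutativeRing)
open import Function.Bundles using (_⇔_)

-- Finite fields (with propositional equality on the carrier).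
-- The inverse is total with the convention 0⁻¹ arbitrary; the axiom
-- only constrains it on nonzero elements.

record FiniteField : Set₁ where
  infixl 7 _*_
  infixl 6 _+_
  field
    Carrier  : Set
    _+_ _*_  : Carrier → Carrier → Carrier
    -_       : Carrier → Carrier
    0# 1#    : Carrier
    _⁻¹      : Carrier → Carrier
    isCommutativeRing : IsCommutativeRing _≡_ _+_ _*_ -_ 0# 1#
    0≢1      : ¬ (0# ≡ 1#)
    ⁻¹-inverse : ∀ x → ¬ (x ≡ 0#) → x * (x ⁻¹) ≡ 1#
    _≟_      : DecidableEquality Carrier
    elements : List Carrier
    complete : ∀ x → x ∈ elements

module Poly (F : FiniteField) where
  open FiniteField F

  -- Polynomials in F[X]: coefficient lists, lowest degree first.
  -- Two lists denote the same polynomial iff all coefficients agree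
  -- (trailing zeros are irrelevant).
  Pol : Set
  Pol = List Carrier

  coeff : Pol → ℕ → Carrier
  coeff []       n       = 0#
  coeff (a ∷ p)  zero    = a
  coeff (a ∷ p)  (suc n) = coeff p n

  infix 4 _≈ₚ_
  _≈ₚ_ : Pol → Pol → Set
  p ≈ₚ q = ∀ n → coeff p n ≡ coeff q n

  infixl 6 _+ₚ_
  _+ₚ_ : Pol → Pol → Pol
  []      +ₚ q       = q
  (a ∷ p) +ₚ []      = a ∷ p
  (a ∷ p) +ₚ (b ∷ q) = (a + b) ∷ (p +ₚ q)

  infixl 7 _*ₚ_
  _*ₚ_ : Pol → Pol → Pol
  []      *ₚ q = []
  (a ∷ p) *ₚ q = map (a *_) q +ₚ (0# ∷ (p *ₚ q))

  oneₚ : Pol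
  oneₚ = 1# ∷ []

  fromℕ : ℕ → Carrier
  fromℕ zero    = 0#
  fromℕ (suc n) = 1# + fromℕ n

  _^_ : Carrier → ℕ → Carrier
  x ^ zero  = 1#
  x ^ suc n = x * (x ^ n)

  derivAux : ℕ → Pol → Pol
  derivAux n []       = []
  derivAux n (a ∷ p)  = (fromℕ n * a) ∷ derivAux (suc n) p

  deriv : Pol → Pol
  deriv []      = []
  deriv (a ∷ p) = derivAux 1 p

  IsConstant : Pol → Set
  IsConstant p = ∀ n → coeff p (suc n) ≡ 0#

  -- irreducible: nonconstant and every factorisation has a constant
  -- (hence unit, since p ≠ 0) factor
  Irreducible : Pol → Set
  Irreducible p = ¬ IsConstant p ×
    (∀ a b → p ≈ₚ a *ₚ b → IsConstant a ⊎ IsConstant b)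

  -- separable: coprime to its formal derivative (standard algebraic
  -- definition, equivalent to having only simple roots in an algebraic
  -- closure)
  Separable : Pol → Set
  Separable p = Σ Pol λ u → Σ Pol λ v → u *ₚ p +ₚ v *ₚ deriv p ≈ₚ oneₚ

  monic : ∀ {k} → Vec Carrier k → Pol
  monic v = V.toList v ++ (1# ∷ [])

  -- λ₀-reciprocal of a polynomial P of degree r:
  --   (1/a₀) X^r P(λ₀/X) = Σ_{j=0}^{r} (a_{r-j} λ₀^{r-j} / a₀) X^j
  recip : Carrier → ℕ → Pol → Pol
  recip λ₀ r p = map (λ j → coeff p (r ∸ j) * (λ₀ ^ (r ∸ j)) * (coeff p 0 ⁻¹))
                     (upTo (suc r))

  -- tuples (P_1,…,P_r) of monic polynomials with deg P_i = d_i
  Tuple : List ℕ → Set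
  Tuple ds = All (Vec Carrier) ds

  polys : ∀ {ds} → Tuple ds → List Pol
  polys []       = []
  polys (v ∷ vs) = monic v ∷ polys vs

  recips : Carrier → ∀ {ds} → Tuple ds → List Pol
  recips λ₀ {[]}     []       = []
  recips λ₀ {d ∷ ds} (v ∷ vs) = recip λ₀ d (monic v) ∷ recips λ₀ vs

  prodₚ : List Pol → Pol
  prodₚ = foldr _*ₚ_ oneₚ

  H : Carrier → ∀ {ds} → Tuple ds → Pol
  H λ₀ t = prodₚ (polys t) *ₚ prodₚ (recips λ₀ t)

  -- membership in I: each P_i irreducible with nonzero constant term
  -- (so that the reciprocal is defined), and H(P) separable
  InI : Carrier → ∀ {ds} → Tuple ds → Set
  InI λ₀ t = All (λ p → Irreducible p × ¬ (coeff p 0 ≡ 0#)) (polys t)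
           × Separable (H λ₀ t)

HasSize : {A : Set} → (A → Set) → ℕ → Set
HasSize {A} S n = Σ (List A) λ xs → Unique xs × length xs ≡ n × (∀ x → (x ∈ xs) ⇔ S x)

IsSortedPartition : List ℕ → ℕ → Set
IsSortedPartition ds h = All (1 ≤_) ds × Linked _≤_ ds × sum ds ≡ h

countEq : ℕ → List ℕ → ℕ
countEq k []       = 0
countEq k (d ∷ ds) with k ℕ.≟ d
... | Relation.Nullary.yes _ = suc (countEq k ds)
... | Relation.Nullary.no  _ = countEq k ds

multiplicity : List ℕ → ℕ → ℕ
multiplicity ds h =
  (2 ℕ.^ length ds) ℕ.* product (map (λ k → (countEq (suc k) ds) ℕ.!) (upTo h))

{-# OPTIONS --safe #-}
-- Write χ = H(P₁,…,P_r) = ∏ᵢ Pᵢ P̃ᵢ. Each Pᵢ, and each P̃ᵢ (reversal is multiplicative and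
-- involutive), is irreducible, hence prime in F[X]. So if also H(Q₁,…,Q_r) = χ, then Q₁ divides χ
-- and is some Pᵢ or P̃ᵢ of the same degree; cancelling Q₁ Q̃₁ = Pᵢ P̃ᵢ and recursing shows that the
-- fibre consists exactly of the tuples obtained by matching the slots of each degree bijectively
-- with the Pᵢ of that degree and then putting Pᵢ or P̃ᵢ in each slot. Separability of χ rules out
-- repeated factors, so these choices give pairwise distinct tuples: 2^r ∏ₖ #{j : dⱼ = k}! of them.
module Submission where

open import Level using (0ℓ)
open import Data.Nat as ℕ using (ℕ; zero; suc; _≤_; _<_; _∸_; z≤n; s≤s)
import Data.Nat.Properties as ℕₚ
open import Data.Nat.ListAction using (sum; product)
open import Data.Nat.Solver using (module +-*-Solver)
open import Data.List using (List; []; _∷_; map; length; applyUpTo; upTo; concatMap; cartesianProductWith)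
import Data.List.Properties as Listₚ
open import Data.List.Relation.Unary.All as All using (All; []; _∷_)
import Data.List.Relation.Unary.All.Properties as Allₚ
open import Data.List.Relation.Unary.Any as Any using (Any; here; there)
import Data.List.Relation.Unary.Any.Properties as Anyₚ
open import Data.List.Relation.Unary.AllPairs as AllPairs using (AllPairs; []; _∷_)
import Data.List.Relation.Unary.AllPairs.Properties as AllPairsₚ
open import Data.List.Relation.Unary.Unique.Propositional using (Unique)
import Data.List.Relation.Unary.Unique.Propositional.Properties as Uniqueₚ
open import Data.List.Relation.Binary.Disjoint.Propositional using (Disjoint)
open import Data.List.Membership.Propositional using (_∈_)
open import Data.List.Membership.Propositional.Properties
  using (∈-map⁺; ∈-upTo⁺; ∈-concatMap⁺; ∈-concatMap⁻; ∈-cartesianProductWith⁺; ∈-cartesianProductWith⁻)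
open import Data.Vec as V using (Vec)
open import Data.Product using (Σ; ∃; _×_; _,_; proj₁; proj₂)
open import Data.Sum using (_⊎_; inj₁; inj₂)
open import Function using (id; _∘_)
open import Function.Bundles using (mk⇔)
open import Relation.Nullary using (¬_; yes; no; contradiction)
open import Relation.Binary.Bundles using (Setoid)
open import Relation.Binary.Structures using (IsEquivalence)
open import Relation.Binary.PropositionalEquality
  using (_≡_; _≢_; refl; sym; trans; cong; cong₂; subst; module ≡-Reasoning)
import Relation.Binary.Reasoning.Setoid as SetoidReasoning
open import Algebra.Bundles using (CommutativeRing)
import Algebra.Properties.AbelianGroup as AbelianGroupProperties
import Algebra.Properties.Group as GroupProperties
import Algebra.Properties.Ring as RingProperties
import Algebra.Properties.Semiring.Divisibility as SemiringDivisibility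
import Algebra.Properties.CommutativeSemigroup.Divisibility as CommutativeSemigroupDivisibility
import Algebra.Properties.Semiring.Primality as SemiringPrimality
import Algebra.Solver.Ring.NaturalCoefficients.Default as NaturalCoefficientSolver
open import Defs

module FieldProperties (F : FiniteField) where
  open FiniteField F

  coefficientRing : CommutativeRing 0ℓ 0ℓ
  coefficientRing = record { isCommutativeRing = isCommutativeRing }

  open CommutativeRing coefficientRing public
    using ( +-comm; +-assoc; +-identityˡ; +-identityʳ; -‿inverseʳ
          ; *-comm; *-assoc; *-identityˡ; *-identityʳ; zeroˡ; zeroʳ; distribˡ; distribʳ )

  module CoefficientSolver =
    NaturalCoefficientSolver (CommutativeRing.commutativeSemiring coefficientRing)

  ⁻¹-inverseˡ : ∀ {x} → x ≢ 0# → x ⁻¹ * x ≡ 1#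
  ⁻¹-inverseˡ {x} x≢0 = trans (*-comm _ _) (⁻¹-inverse x x≢0)

  *-cancelˡ-0 : ∀ {c x} → c ≢ 0# → c * x ≡ 0# → x ≡ 0#
  *-cancelˡ-0 {c} {x} c≢0 cx≡0 = begin
    x                ≡⟨ *-identityˡ x ⟨
    1# * x           ≡⟨ cong (_* x) (⁻¹-inverseˡ c≢0) ⟨
    c ⁻¹ * c * x     ≡⟨ *-assoc _ _ _ ⟩
    c ⁻¹ * (c * x)   ≡⟨ cong (c ⁻¹ *_) cx≡0 ⟩
    c ⁻¹ * 0#        ≡⟨ zeroʳ _ ⟩
    0#               ∎
    where open ≡-Reasoning

  *-≢0 : ∀ {x y} → x ≢ 0# → y ≢ 0# → x * y ≢ 0#
  *-≢0 x≢0 y≢0 xy≡0 = y≢0 (*-cancelˡ-0 x≢0 xy≡0)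

  ⁻¹-≢0 : ∀ {x} → x ≢ 0# → x ⁻¹ ≢ 0#
  ⁻¹-≢0 {x} x≢0 x⁻¹≡0 = 0≢1 (trans (sym (zeroʳ x)) (trans (cong (x *_) (sym x⁻¹≡0)) (⁻¹-inverse x x≢0)))

module PolynomialRing (F : FiniteField) where
  open FiniteField F
  open Poly F
  open FieldProperties F public

  -- A record rather than _≈ₚ_ itself, so that both polynomials can be inferred.
  infix 4 _≃_
  record _≃_ (p q : Pol) : Set where
    constructor mk≃
    field coeff-≡ : p ≈ₚ q
  open _≃_ public

  ≃-refl : ∀ {p} → p ≃ p
  ≃-refl = mk≃ λ _ → refl

  ≃-sym : ∀ {p q} → p ≃ q → q ≃ p
  ≃-sym (mk≃ e) = mk≃ λ n → sym (e n)

  ≃-trans : ∀ {p q r} → p ≃ q → q ≃ r → p ≃ r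
  ≃-trans (mk≃ e) (mk≃ f) = mk≃ λ n → trans (e n) (f n)

  ≃-reflexive : ∀ {p q} → p ≡ q → p ≃ q
  ≃-reflexive refl = ≃-refl

  ≃-isEquivalence : IsEquivalence _≃_
  ≃-isEquivalence = record { refl = ≃-refl ; sym = ≃-sym ; trans = ≃-trans }

  ≃-setoid : Setoid 0ℓ 0ℓ
  ≃-setoid = record { isEquivalence = ≃-isEquivalence }

  scale : Carrier → Pol → Pol
  scale a = map (a *_)

  negₚ : Pol → Pol
  negₚ = map -_

  coeff-+ₚ : ∀ p q n → coeff (p +ₚ q) n ≡ coeff p n + coeff q n
  coeff-+ₚ []      q       n       = sym (+-identityˡ _)
  coeff-+ₚ (a ∷ p) []      n       = sym (+-identityʳ _)
  coeff-+ₚ (a ∷ p) (b ∷ q) zero    = refl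
  coeff-+ₚ (a ∷ p) (b ∷ q) (suc n) = coeff-+ₚ p q n

  coeff-scale : ∀ a p n → coeff (scale a p) n ≡ a * coeff p n
  coeff-scale a []      n       = sym (zeroʳ a)
  coeff-scale a (b ∷ p) zero    = refl
  coeff-scale a (b ∷ p) (suc n) = coeff-scale a p n

  coeff-negₚ : ∀ p n → coeff (negₚ p) n ≡ - coeff p n
  coeff-negₚ []      n       = sym (trans (sym (+-identityˡ _)) (-‿inverseʳ 0#))
  coeff-negₚ (a ∷ p) zero    = refl
  coeff-negₚ (a ∷ p) (suc n) = coeff-negₚ p n

  ∷-cong : ∀ {a b p q} → a ≡ b → p ≃ q → a ∷ p ≃ b ∷ q
  ∷-cong a≡b (mk≃ p≈q) = mk≃ λ where
    zero    → a≡b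
    (suc n) → p≈q n

  ∷-injectiveˡ : ∀ {a b p q} → a ∷ p ≃ b ∷ q → a ≡ b
  ∷-injectiveˡ (mk≃ e) = e 0

  ∷-injectiveʳ : ∀ {a b p q} → a ∷ p ≃ b ∷ q → p ≃ q
  ∷-injectiveʳ (mk≃ e) = mk≃ λ n → e (suc n)

  0∷-zero : ∀ {p} → p ≃ [] → 0# ∷ p ≃ []
  0∷-zero (mk≃ e) = mk≃ λ where
    zero    → refl
    (suc n) → e n

  []≃0∷[] : [] ≃ 0# ∷ []
  []≃0∷[] = ≃-sym (0∷-zero ≃-refl)

  +ₚ-cong : ∀ {p p′ q q′} → p ≃ p′ → q ≃ q′ → p +ₚ q ≃ p′ +ₚ q′
  +ₚ-cong {p} {p′} {q} {q′} (mk≃ e) (mk≃ f) = mk≃ λ n → begin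
    coeff (p +ₚ q) n        ≡⟨ coeff-+ₚ p q n ⟩
    coeff p n + coeff q n   ≡⟨ cong₂ _+_ (e n) (f n) ⟩
    coeff p′ n + coeff q′ n ≡⟨ coeff-+ₚ p′ q′ n ⟨
    coeff (p′ +ₚ q′) n      ∎
    where open ≡-Reasoning

  +ₚ-identityʳ : ∀ p → p +ₚ [] ≃ p
  +ₚ-identityʳ []      = ≃-refl
  +ₚ-identityʳ (a ∷ p) = ≃-refl

  +ₚ-comm : ∀ p q → p +ₚ q ≃ q +ₚ p
  +ₚ-comm p q = mk≃ λ n →
    trans (coeff-+ₚ p q n) (trans (+-comm _ _) (sym (coeff-+ₚ q p n)))

  +ₚ-assoc : ∀ p q r → (p +ₚ q) +ₚ r ≃ p +ₚ (q +ₚ r)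
  +ₚ-assoc p q r = mk≃ λ n → begin
    coeff ((p +ₚ q) +ₚ r) n               ≡⟨ coeff-+ₚ (p +ₚ q) r n ⟩
    coeff (p +ₚ q) n + coeff r n          ≡⟨ cong (_+ coeff r n) (coeff-+ₚ p q n) ⟩
    coeff p n + coeff q n + coeff r n     ≡⟨ +-assoc _ _ _ ⟩
    coeff p n + (coeff q n + coeff r n)   ≡⟨ cong (coeff p n +_) (coeff-+ₚ q r n) ⟨
    coeff p n + coeff (q +ₚ r) n          ≡⟨ coeff-+ₚ p (q +ₚ r) n ⟨
    coeff (p +ₚ (q +ₚ r)) n               ∎
    where open ≡-Reasoning

  negₚ-cong : ∀ {p q} → p ≃ q → negₚ p ≃ negₚ q
  negₚ-cong {p} {q} (mk≃ e) = mk≃ λ n →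
    trans (coeff-negₚ p n) (trans (cong -_ (e n)) (sym (coeff-negₚ q n)))

  negₚ-inverseʳ : ∀ p → p +ₚ negₚ p ≃ []
  negₚ-inverseʳ p = mk≃ λ n →
    trans (coeff-+ₚ p (negₚ p) n) (trans (cong (coeff p n +_) (coeff-negₚ p n)) (-‿inverseʳ _))

  scale-cong : ∀ {a b p q} → a ≡ b → p ≃ q → scale a p ≃ scale b q
  scale-cong {a} {_} {p} {q} refl (mk≃ e) = mk≃ λ n →
    trans (coeff-scale a p n) (trans (cong (a *_) (e n)) (sym (coeff-scale a q n)))

  scale-distribˡ : ∀ a p q → scale a (p +ₚ q) ≃ scale a p +ₚ scale a q
  scale-distribˡ a p q = mk≃ λ n → begin
    coeff (scale a (p +ₚ q)) n                   ≡⟨ coeff-scale a (p +ₚ q) n ⟩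
    a * coeff (p +ₚ q) n                         ≡⟨ cong (a *_) (coeff-+ₚ p q n) ⟩
    a * (coeff p n + coeff q n)                  ≡⟨ distribˡ a _ _ ⟩
    a * coeff p n + a * coeff q n                ≡⟨ cong₂ _+_ (coeff-scale a p n) (coeff-scale a q n) ⟨
    coeff (scale a p) n + coeff (scale a q) n    ≡⟨ coeff-+ₚ (scale a p) (scale a q) n ⟨
    coeff (scale a p +ₚ scale a q) n             ∎
    where open ≡-Reasoning

  scale-distribʳ : ∀ a b p → scale (a + b) p ≃ scale a p +ₚ scale b p
  scale-distribʳ a b p = mk≃ λ n → begin
    coeff (scale (a + b) p) n                    ≡⟨ coeff-scale (a + b) p n ⟩
    (a + b) * coeff p n                          ≡⟨ distribʳ (coeff p n) a b ⟩
    a * coeff p n + b * coeff p n                ≡⟨ cong₂ _+_ (coeff-scale a p n) (coeff-scale b p n) ⟨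
    coeff (scale a p) n + coeff (scale b p) n    ≡⟨ coeff-+ₚ (scale a p) (scale b p) n ⟨
    coeff (scale a p +ₚ scale b p) n             ∎
    where open ≡-Reasoning

  scale-scale : ∀ a b p → scale a (scale b p) ≃ scale (a * b) p
  scale-scale a b p = mk≃ λ n → begin
    coeff (scale a (scale b p)) n  ≡⟨ coeff-scale a (scale b p) n ⟩
    a * coeff (scale b p) n        ≡⟨ cong (a *_) (coeff-scale b p n) ⟩
    a * (b * coeff p n)            ≡⟨ *-assoc a b _ ⟨
    a * b * coeff p n              ≡⟨ coeff-scale (a * b) p n ⟨
    coeff (scale (a * b) p) n      ∎
    where open ≡-Reasoning

  scale-identity : ∀ p → scale 1# p ≃ p
  scale-identity p = mk≃ λ n → trans (coeff-scale 1# p n) (*-identityˡ _)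

  scale-zero : ∀ p → scale 0# p ≃ []
  scale-zero p = mk≃ λ n → trans (coeff-scale 0# p n) (zeroˡ _)

  *ₚ-zeroʳ : ∀ p → p *ₚ [] ≃ []
  *ₚ-zeroʳ []      = ≃-refl
  *ₚ-zeroʳ (a ∷ p) = 0∷-zero (*ₚ-zeroʳ p)

  *ₚ-zeroˡ : ∀ {p} q → p ≃ [] → p *ₚ q ≃ []
  *ₚ-zeroˡ {[]}    q p≃[] = ≃-refl
  *ₚ-zeroˡ {a ∷ p} q p≃[] = ≃-trans
    (+ₚ-cong (≃-trans (scale-cong (coeff-≡ p≃[] 0) ≃-refl) (scale-zero q)) ≃-refl)
    (0∷-zero (*ₚ-zeroˡ q (mk≃ {p} λ n → coeff-≡ p≃[] (suc n))))

  const-*ₚ : ∀ a q → (a ∷ []) *ₚ q ≃ scale a q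
  const-*ₚ a q = ≃-trans (+ₚ-cong ≃-refl (0∷-zero ≃-refl)) (+ₚ-identityʳ _)

  +ₚ-swapˡ : ∀ p q r → p +ₚ (q +ₚ r) ≃ q +ₚ (p +ₚ r)
  +ₚ-swapˡ p q r =
    ≃-trans (≃-sym (+ₚ-assoc p q r)) (≃-trans (+ₚ-cong (+ₚ-comm p q) ≃-refl) (+ₚ-assoc q p r))

  *ₚ-∷ʳ : ∀ p b q → p *ₚ (b ∷ q) ≃ scale b p +ₚ (0# ∷ p *ₚ q)
  *ₚ-∷ʳ []      b q = ≃-sym (0∷-zero ≃-refl)
  *ₚ-∷ʳ (a ∷ p) b q = ∷-cong (cong (_+ 0#) (*-comm a b))
    (≃-trans (+ₚ-cong ≃-refl (*ₚ-∷ʳ p b q)) (+ₚ-swapˡ (scale a q) (scale b p) _))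

  *ₚ-comm : ∀ p q → p *ₚ q ≃ q *ₚ p
  *ₚ-comm []      q = ≃-sym (*ₚ-zeroʳ q)
  *ₚ-comm (a ∷ p) q = ≃-trans (+ₚ-cong ≃-refl (∷-cong refl (*ₚ-comm p q))) (≃-sym (*ₚ-∷ʳ q a p))

  *ₚ-congʳ : ∀ {p p′} q → p ≃ p′ → p *ₚ q ≃ p′ *ₚ q
  *ₚ-congʳ {[]}    {p′}     q e = ≃-sym (*ₚ-zeroˡ q (≃-sym e))
  *ₚ-congʳ {a ∷ p} {[]}     q e = *ₚ-zeroˡ q e
  *ₚ-congʳ {a ∷ p} {a′ ∷ p′} q e =
    +ₚ-cong (scale-cong (∷-injectiveˡ e) ≃-refl) (∷-cong refl (*ₚ-congʳ q (∷-injectiveʳ e)))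

  *ₚ-cong : ∀ {p p′ q q′} → p ≃ p′ → q ≃ q′ → p *ₚ q ≃ p′ *ₚ q′
  *ₚ-cong {p} {p′} {q} {q′} p≃p′ q≃q′ = ≃-trans (*ₚ-congʳ q p≃p′)
    (≃-trans (*ₚ-comm p′ q) (≃-trans (*ₚ-congʳ p′ q≃q′) (*ₚ-comm q′ p′)))

  *ₚ-distribʳ : ∀ q p p′ → (p +ₚ p′) *ₚ q ≃ p *ₚ q +ₚ p′ *ₚ q
  *ₚ-distribʳ q []      p′       = ≃-refl
  *ₚ-distribʳ q (a ∷ p) []       = ≃-sym (+ₚ-identityʳ _)
  *ₚ-distribʳ q (a ∷ p) (b ∷ p′) = ≃-trans
    (+ₚ-cong (scale-distribʳ a b q)
             (∷-cong (sym (+-identityˡ 0#)) (*ₚ-distribʳ q p p′)))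
    (+ₚ-interchange (scale a q) (scale b q) _ _)
    where
      +ₚ-interchange : ∀ w x y z → (w +ₚ x) +ₚ (y +ₚ z) ≃ (w +ₚ y) +ₚ (x +ₚ z)
      +ₚ-interchange w x y z = ≃-trans (+ₚ-assoc w x _)
        (≃-trans (+ₚ-cong (≃-refl {w}) (+ₚ-swapˡ x y z)) (≃-sym (+ₚ-assoc w y _)))

  scale-*ₚ : ∀ a p q → scale a p *ₚ q ≃ scale a (p *ₚ q)
  scale-*ₚ a []      q = ≃-refl
  scale-*ₚ a (b ∷ p) q = ≃-trans
    (+ₚ-cong (≃-sym (scale-scale a b q)) (∷-cong (sym (zeroʳ a)) (scale-*ₚ a p q)))
    (≃-sym (scale-distribˡ a (scale b q) (0# ∷ p *ₚ q)))

  0∷-*ₚ : ∀ p q → (0# ∷ p) *ₚ q ≃ 0# ∷ p *ₚ q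
  0∷-*ₚ p q = +ₚ-cong (scale-zero q) ≃-refl

  *ₚ-assoc : ∀ p q r → (p *ₚ q) *ₚ r ≃ p *ₚ (q *ₚ r)
  *ₚ-assoc []      q r = ≃-refl
  *ₚ-assoc (a ∷ p) q r = ≃-trans (*ₚ-distribʳ r (scale a q) (0# ∷ p *ₚ q))
    (+ₚ-cong (scale-*ₚ a q r) (≃-trans (0∷-*ₚ (p *ₚ q) r) (∷-cong refl (*ₚ-assoc p q r))))

  *ₚ-identityˡ : ∀ p → oneₚ *ₚ p ≃ p
  *ₚ-identityˡ p = ≃-trans (const-*ₚ 1# p) (scale-identity p)

  polynomialRing : CommutativeRing 0ℓ 0ℓ
  polynomialRing = record
    { Carrier = Pol
    ; _≈_ = _≃_
    ; _+_ = _+ₚ_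
    ; _*_ = _*ₚ_
    ; -_ = negₚ
    ; 0# = []
    ; 1# = oneₚ
    ; isCommutativeRing = record
      { isRing = record
        { +-isAbelianGroup = record
          { isGroup = record
            { isMonoid = record
              { isSemigroup = record
                { isMagma = record { isEquivalence = ≃-isEquivalence ; ∙-cong = +ₚ-cong }
                ; assoc = +ₚ-assoc }
              ; identity = (λ _ → ≃-refl) , +ₚ-identityʳ }
            ; inverse = (λ p → ≃-trans (+ₚ-comm (negₚ p) p) (negₚ-inverseʳ p)) , negₚ-inverseʳ
            ; ⁻¹-cong = negₚ-cong }
          ; comm = +ₚ-comm }
        ; *-cong = *ₚ-cong
        ; *-assoc = *ₚ-assoc
        ; *-identity = *ₚ-identityˡ , (λ p → ≃-trans (*ₚ-comm p oneₚ) (*ₚ-identityˡ p))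
        ; distrib = (λ p q r → ≃-trans (*ₚ-comm p _) (≃-trans (*ₚ-distribʳ p q r)
                                  (+ₚ-cong (*ₚ-comm q p) (*ₚ-comm r p))))
                  , *ₚ-distribʳ }
      ; *-comm = *ₚ-comm } }

  module PolynomialSolver =
    NaturalCoefficientSolver (CommutativeRing.commutativeSemiring polynomialRing)

  module ≃-Reasoning = SetoidReasoning ≃-setoid

module Degree (F : FiniteField) where
  open FiniteField F
  open Poly F
  open PolynomialRing F public

  record DegreeBelow (p : Pol) (n : ℕ) : Set where
    constructor degreeBelow
    field coeff-≥ : ∀ k → n ≤ k → coeff p k ≡ 0#
  open DegreeBelow public

  HasDegree : Pol → ℕ → Set
  HasDegree p n = coeff p n ≢ 0# × DegreeBelow p (suc n)

  DegreeBelow-resp-≃ : ∀ {p q n} → p ≃ q → DegreeBelow p n → DegreeBelow q n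
  DegreeBelow-resp-≃ (mk≃ e) (degreeBelow p<n) = degreeBelow λ k n≤k → trans (sym (e k)) (p<n k n≤k)

  HasDegree-resp-≃ : ∀ {p q n} → p ≃ q → HasDegree p n → HasDegree q n
  HasDegree-resp-≃ {n = n} p≃q (lead≢0 , p<n) =
    (λ lead≡0 → lead≢0 (trans (coeff-≡ p≃q n) lead≡0)) , DegreeBelow-resp-≃ p≃q p<n

  DegreeBelow-mono : ∀ {p m n} → m ≤ n → DegreeBelow p m → DegreeBelow p n
  DegreeBelow-mono m≤n (degreeBelow p<m) = degreeBelow λ k n≤k → p<m k (ℕₚ.≤-trans m≤n n≤k)

  degreeBelow-length : ∀ p → DegreeBelow p (length p)
  degreeBelow-length []      = degreeBelow λ _ _ → refl
  degreeBelow-length (a ∷ p) = degreeBelow λ where (suc k) (s≤s l≤k) → coeff-≥ (degreeBelow-length p) k l≤k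

  degreeBelow0⇒≃[] : ∀ {p} → DegreeBelow p 0 → p ≃ []
  degreeBelow0⇒≃[] p<0 = mk≃ λ k → coeff-≥ p<0 k z≤n

  degreeBelow1⇒isConstant : ∀ {p} → DegreeBelow p 1 → IsConstant p
  degreeBelow1⇒isConstant p<1 k = coeff-≥ p<1 (suc k) (s≤s z≤n)

  isConstant⇒degreeBelow1 : ∀ {p} → IsConstant p → DegreeBelow p 1
  isConstant⇒degreeBelow1 p-const = degreeBelow λ where (suc k) _ → p-const k

  isConstant⇒≃const : ∀ {p} → IsConstant p → p ≃ coeff p 0 ∷ []
  isConstant⇒≃const {[]}    _       = []≃0∷[]
  isConstant⇒≃const {a ∷ p} p-const = ∷-cong refl (mk≃ {p} p-const)

  IsConstant-resp-≃ : ∀ {p q} → p ≃ q → IsConstant p → IsConstant q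
  IsConstant-resp-≃ p≃q p-const k = trans (sym (coeff-≡ p≃q (suc k))) (p-const k)

  +ₚ-degreeBelow : ∀ {p q n} → DegreeBelow p n → DegreeBelow q n → DegreeBelow (p +ₚ q) n
  +ₚ-degreeBelow {p} {q} p<n q<n = degreeBelow λ k n≤k →
    trans (coeff-+ₚ p q k) (trans (cong₂ _+_ (coeff-≥ p<n k n≤k) (coeff-≥ q<n k n≤k)) (+-identityˡ 0#))

  scale-degreeBelow : ∀ c {p n} → DegreeBelow p n → DegreeBelow (scale c p) n
  scale-degreeBelow c {p} p<n = degreeBelow λ k n≤k →
    trans (coeff-scale c p k) (trans (cong (c *_) (coeff-≥ p<n k n≤k)) (zeroʳ c))

  tail-degreeBelow : ∀ {a p n} → DegreeBelow (a ∷ p) (suc n) → DegreeBelow p n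
  tail-degreeBelow (degreeBelow a∷p<n) = degreeBelow λ k n≤k → a∷p<n (suc k) (s≤s n≤k)

  hasDegree⇒< : ∀ {p m n} → HasDegree p m → DegreeBelow p n → m < n
  hasDegree⇒< {m = m} {n} (lead≢0 , _) p<n with m ℕₚ.<? n
  ... | yes m<n = m<n
  ... | no  m≮n = contradiction (coeff-≥ p<n m (ℕₚ.≮⇒≥ m≮n)) lead≢0

  hasDegree-unique : ∀ {p m n} → HasDegree p m → HasDegree p n → m ≡ n
  hasDegree-unique p°m p°n = ℕₚ.≤-antisym (ℕₚ.≤-pred (hasDegree⇒< p°m (proj₂ p°n)))
                                              (ℕₚ.≤-pred (hasDegree⇒< p°n (proj₂ p°m)))

  ≃[]⊎hasDegree : ∀ p → p ≃ [] ⊎ ∃ (HasDegree p)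
  ≃[]⊎hasDegree []      = inj₁ ≃-refl
  ≃[]⊎hasDegree (a ∷ p) with ≃[]⊎hasDegree p
  ... | inj₂ (n , lead≢0 , p<n) = inj₂ (suc n , lead≢0 , degreeBelow λ where (suc k) (s≤s n<k) → coeff-≥ p<n k n<k)
  ... | inj₁ p≃[] with a ≟ 0#
  ...   | yes a≡0 = inj₁ (≃-trans (∷-cong a≡0 p≃[]) (0∷-zero ≃-refl))
  ...   | no  a≢0 = inj₂ (0 , a≢0 , degreeBelow λ where (suc k) _ → coeff-≡ p≃[] k)

  *ₚ-degreeBelow : ∀ {a b} m n → DegreeBelow a m → DegreeBelow b (suc n) → DegreeBelow (a *ₚ b) (m ℕ.+ n)
  *ₚ-degreeBelow {b = b} m n a<m b<n = degreeBelow (vanishes m a<m)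
    where
      vanishes : ∀ {a} m → DegreeBelow a m → ∀ k → m ℕ.+ n ≤ k → coeff (a *ₚ b) k ≡ 0#
      vanishes {a}     zero    a<0 k _ = coeff-≡ (*ₚ-zeroˡ b (degreeBelow0⇒≃[] a<0)) k
      vanishes {[]}    (suc m) _   k _ = refl
      vanishes {c ∷ a} (suc m) a<m (suc k) (s≤s m+n≤k) = begin
        coeff (scale c b +ₚ (0# ∷ a *ₚ b)) (suc k)
          ≡⟨ coeff-+ₚ (scale c b) _ (suc k) ⟩
        coeff (scale c b) (suc k) + coeff (a *ₚ b) k
          ≡⟨ cong₂ _+_ (coeff-scale c b (suc k)) (vanishes m (tail-degreeBelow a<m) k m+n≤k) ⟩
        c * coeff b (suc k) + 0#
          ≡⟨ cong (λ x → c * x + 0#) (coeff-≥ b<n (suc k) (s≤s (ℕₚ.≤-trans (ℕₚ.m≤n+m n m) m+n≤k))) ⟩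
        c * 0# + 0#
          ≡⟨ trans (+-identityʳ _) (zeroʳ c) ⟩
        0#
          ∎
        where open ≡-Reasoning

  coeff-*ₚ-top : ∀ {a b} m n → DegreeBelow a (suc m) → DegreeBelow b (suc n) →
                 coeff (a *ₚ b) (m ℕ.+ n) ≡ coeff a m * coeff b n
  coeff-*ₚ-top {[]}    m n _ _ = sym (zeroˡ _)
  coeff-*ₚ-top {c ∷ a} {b} zero n a<1 b<n = begin
    coeff (scale c b +ₚ (0# ∷ a *ₚ b)) n
      ≡⟨ coeff-+ₚ (scale c b) _ n ⟩
    coeff (scale c b) n + coeff (0# ∷ a *ₚ b) n
      ≡⟨ cong₂ _+_ (coeff-scale c b n) (coeff-≡ (0∷-zero (*ₚ-zeroˡ b a≃[])) n) ⟩
    c * coeff b n + 0#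
      ≡⟨ +-identityʳ _ ⟩
    c * coeff b n
      ∎
    where
      open ≡-Reasoning
      a≃[] : a ≃ []
      a≃[] = degreeBelow0⇒≃[] (tail-degreeBelow a<1)
  coeff-*ₚ-top {c ∷ a} {b} (suc m) n a<m b<n = begin
    coeff (scale c b +ₚ (0# ∷ a *ₚ b)) (suc (m ℕ.+ n))      ≡⟨ coeff-+ₚ (scale c b) _ (suc (m ℕ.+ n)) ⟩
    coeff (scale c b) (suc (m ℕ.+ n)) + coeff (a *ₚ b) (m ℕ.+ n)
      ≡⟨ cong₂ _+_ (coeff-scale c b _) (coeff-*ₚ-top m n (tail-degreeBelow a<m) b<n) ⟩
    c * coeff b (suc (m ℕ.+ n)) + coeff a m * coeff b n
      ≡⟨ cong (λ x → c * x + coeff a m * coeff b n) (coeff-≥ b<n _ (s≤s (ℕₚ.m≤n+m n m))) ⟩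
    c * 0# + coeff a m * coeff b n                           ≡⟨ cong (_+ coeff a m * coeff b n) (zeroʳ c) ⟩
    0# + coeff a m * coeff b n                               ≡⟨ +-identityˡ _ ⟩
    coeff a m * coeff b n                                    ∎
    where open ≡-Reasoning

  coeff-*ₚ-0 : ∀ a b → coeff (a *ₚ b) 0 ≡ coeff a 0 * coeff b 0
  coeff-*ₚ-0 []      b = sym (zeroˡ _)
  coeff-*ₚ-0 (c ∷ a) b = trans (coeff-+ₚ (scale c b) (0# ∷ a *ₚ b) 0) (trans (+-identityʳ _) (coeff-scale c b 0))

  hasDegree-*ₚ : ∀ {a b m n} → HasDegree a m → HasDegree b n → HasDegree (a *ₚ b) (m ℕ.+ n)
  hasDegree-*ₚ {m = m} {n} (a-lead≢0 , a<m) (b-lead≢0 , b<n) =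
    (λ lead≡0 → *-≢0 a-lead≢0 b-lead≢0 (trans (sym (coeff-*ₚ-top m n a<m b<n)) lead≡0)) ,
    *ₚ-degreeBelow (suc m) n a<m b<n

  hasDegree⇒≄[] : ∀ {p n} → HasDegree p n → ¬ p ≃ []
  hasDegree⇒≄[] {n = n} (lead≢0 , _) p≃[] = lead≢0 (coeff-≡ p≃[] n)

  *ₚ-≄[] : ∀ {a b} → ¬ a ≃ [] → ¬ b ≃ [] → ¬ a *ₚ b ≃ []
  *ₚ-≄[] {a} {b} a≄[] b≄[] with ≃[]⊎hasDegree a | ≃[]⊎hasDegree b
  ... | inj₁ a≃[]      | _              = contradiction a≃[] a≄[]
  ... | inj₂ _         | inj₁ b≃[]      = contradiction b≃[] b≄[]
  ... | inj₂ (_ , a°)  | inj₂ (_ , b°)  = hasDegree⇒≄[] (hasDegree-*ₚ a° b°)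

  *ₚ-cancelˡ : ∀ {a b c} → ¬ a ≃ [] → a *ₚ b ≃ a *ₚ c → b ≃ c
  *ₚ-cancelˡ {a} {b} {c} a≄[] ab≃ac = x∙y⁻¹≈ε⇒x≈y b c (difference≃[] (≃[]⊎hasDegree (b +ₚ negₚ c)))
    where
      open GroupProperties (CommutativeRing.+-group polynomialRing) using (x∙y⁻¹≈ε⇒x≈y; x≈y⇒x∙y⁻¹≈ε)
      open RingProperties (CommutativeRing.ring polynomialRing) using (x[y-z]≈xy-xz)
      a[b-c]≃[] : a *ₚ (b +ₚ negₚ c) ≃ []
      a[b-c]≃[] = ≃-trans (x[y-z]≈xy-xz a b c) (x≈y⇒x∙y⁻¹≈ε ab≃ac)
      difference≃[] : _ ⊎ _ → b +ₚ negₚ c ≃ []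
      difference≃[] (inj₁ b-c≃[])    = b-c≃[]
      difference≃[] (inj₂ (_ , b-c°)) = contradiction a[b-c]≃[] (*ₚ-≄[] a≄[] (hasDegree⇒≄[] b-c°))

  oneₚ-hasDegree : HasDegree oneₚ 0
  oneₚ-hasDegree = (λ 1≡0 → 0≢1 (sym 1≡0)) , degreeBelow λ where (suc k) _ → refl

  *ₚ≃oneₚ⇒isConstant : ∀ {a b} → a *ₚ b ≃ oneₚ → IsConstant a
  *ₚ≃oneₚ⇒isConstant {a} {b} ab≃1 with ≃[]⊎hasDegree a | ≃[]⊎hasDegree b
  ... | inj₁ a≃[] | _ = contradiction (≃-trans (≃-sym ab≃1) (*ₚ-zeroˡ b a≃[])) (hasDegree⇒≄[] oneₚ-hasDegree)
  ... | inj₂ _    | inj₁ b≃[] = contradiction (≃-trans (≃-sym ab≃1) (≃-trans (*ₚ-cong (≃-refl {a}) b≃[]) (*ₚ-zeroʳ a)))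
                                             (hasDegree⇒≄[] oneₚ-hasDegree)
  ... | inj₂ (zero , a°)  | inj₂ _        = degreeBelow1⇒isConstant (proj₂ a°)
  ... | inj₂ (suc m , a°) | inj₂ (n , b°)
    with () ← hasDegree-unique (HasDegree-resp-≃ ab≃1 (hasDegree-*ₚ a° b°)) oneₚ-hasDegree

module Euclid (F : FiniteField) where
  open FiniteField F
  open Poly F
  open Degree F public
  open SemiringDivisibility (CommutativeRing.semiring polynomialRing) public
    using (_∣_; _,_; ∣ʳ-refl; ∣ʳ-reflexive; ∣ʳ-trans; ∣ʳ-respˡ-≈; ∣ʳ-respʳ-≈; x∣ʳy⇒x∣ʳzy; _∣0)
  open CommutativeSemigroupDivisibility (CommutativeRing.*-commutativeSemigroup polynomialRing) public
    using (x∣xy; xy≈z⇒x∣z; ∙-cong-∣)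
  open SemiringPrimality (CommutativeRing.semiring polynomialRing) public
    using (Prime; mkPrime)
  open PolynomialSolver using (solve; _:=_; _:+_; _:*_)

  minusOneₚ : Pol
  minusOneₚ = - 1# ∷ []

  -- Writing negation as a product lets the semiring solver handle it.
  negₚ≃minusOneₚ*ₚ : ∀ p → negₚ p ≃ minusOneₚ *ₚ p
  negₚ≃minusOneₚ*ₚ p = ≃-trans (mk≃ λ n → trans (coeff-negₚ p n) (trans (sym (-1*x≈-x _)) (sym (coeff-scale (- 1#) p n))))
                               (≃-sym (const-*ₚ (- 1#) p))
    where open RingProperties (CommutativeRing.ring coefficientRing) using (-1*x≈-x)

  ≃-+ₚ-difference : ∀ x y → x ≃ y +ₚ (x +ₚ negₚ y)
  ≃-+ₚ-difference x y = ≃-sym (≃-trans (≃-sym (+ₚ-assoc y x (negₚ y))) (xyx⁻¹≈y y x))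
    where open AbelianGroupProperties (CommutativeRing.+-abelianGroup polynomialRing) using (xyx⁻¹≈y)

  divMod : ∀ {b n} → HasDegree b n → ∀ a →
           Σ Pol λ q → Σ Pol λ r → a ≃ q *ₚ b +ₚ r × DegreeBelow r n
  divMod b° [] = [] , [] , ≃-refl , degreeBelow λ _ _ → refl
  divMod {b} {n} b°@(β≢0 , b<n) (a ∷ p) with divMod b° p
  ... | q , r , p≃qb+r , r<n = c ∷ q , r′ , a∷p≃ , r′<n
    where
      β : Carrier
      β = coeff b n
      c : Carrier
      c = coeff (a ∷ r) n * β ⁻¹
      r′ : Pol
      r′ = (a ∷ r) +ₚ negₚ (scale c b)

      a∷p≃ : a ∷ p ≃ (c ∷ q) *ₚ b +ₚ r′
      a∷p≃ = begin
        a ∷ p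
          ≈⟨ ∷-cong (sym (+-identityˡ a)) p≃qb+r ⟩
        (0# ∷ q *ₚ b) +ₚ (a ∷ r)
          ≈⟨ +ₚ-cong (≃-refl {0# ∷ q *ₚ b}) (≃-+ₚ-difference (a ∷ r) (scale c b)) ⟩
        (0# ∷ q *ₚ b) +ₚ (scale c b +ₚ r′)
          ≈⟨ solve 3 (λ x y z → x :+ (y :+ z) := (y :+ x) :+ z) ≃-refl
                                                   (0# ∷ q *ₚ b) (scale c b) r′ ⟩
        (c ∷ q) *ₚ b +ₚ r′
          ∎
        where open ≃-Reasoning

      cancels : ∀ k → n ≤ k → coeff (a ∷ r) k ≡ c * coeff b k
      cancels k n≤k with ℕₚ.m≤n⇒m<n∨m≡n n≤k
      ... | inj₁ n<k@(s≤s n≤k′) = trans (coeff-≥ r<n _ n≤k′) (sym (trans (cong (c *_) (coeff-≥ b<n k n<k)) (zeroʳ c)))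
      ... | inj₂ refl = sym (begin
        coeff (a ∷ r) n * β ⁻¹ * β   ≡⟨ *-assoc _ _ _ ⟩
        coeff (a ∷ r) n * (β ⁻¹ * β) ≡⟨ cong (coeff (a ∷ r) n *_) (⁻¹-inverseˡ β≢0) ⟩
        coeff (a ∷ r) n * 1#         ≡⟨ *-identityʳ _ ⟩
        coeff (a ∷ r) n              ∎)
        where open ≡-Reasoning

      r′<n : DegreeBelow r′ n
      r′<n = degreeBelow λ k n≤k → begin
        coeff r′ k
          ≡⟨ coeff-+ₚ (a ∷ r) (negₚ (scale c b)) k ⟩
        coeff (a ∷ r) k + coeff (negₚ (scale c b)) k
          ≡⟨ cong (coeff (a ∷ r) k +_) (trans (coeff-negₚ (scale c b) k) (cong -_ (coeff-scale c b k))) ⟩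
        coeff (a ∷ r) k + - (c * coeff b k)
          ≡⟨ x≈y⇒x∙y⁻¹≈ε (cancels k n≤k) ⟩
        0#
          ∎
        where
          open ≡-Reasoning
          open GroupProperties (CommutativeRing.+-group coefficientRing) using (x≈y⇒x∙y⁻¹≈ε)

  ∣-+ₚ : ∀ {g x y} → g ∣ x → g ∣ y → g ∣ x +ₚ y
  ∣-+ₚ {g} (k , kg≃x) (l , lg≃y) = k +ₚ l , ≃-trans (*ₚ-distribʳ g k l) (+ₚ-cong kg≃x lg≃y)

  nonzeroConstant∣oneₚ : ∀ {p} → IsConstant p → ¬ p ≃ [] → p ∣ oneₚ
  nonzeroConstant∣oneₚ {p} p-const p≄[] = (coeff p 0 ⁻¹ ∷ []) , (begin
    (coeff p 0 ⁻¹ ∷ []) *ₚ p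
      ≈⟨ *ₚ-cong (≃-refl {coeff p 0 ⁻¹ ∷ []}) (isConstant⇒≃const p-const) ⟩
    (coeff p 0 ⁻¹ ∷ []) *ₚ (coeff p 0 ∷ [])
      ≈⟨ const-*ₚ (coeff p 0 ⁻¹) (coeff p 0 ∷ []) ⟩
    coeff p 0 ⁻¹ * coeff p 0 ∷ []
      ≈⟨ ∷-cong (⁻¹-inverseˡ p₀≢0) ≃-refl ⟩
    oneₚ
      ∎)
    where
      open ≃-Reasoning
      p₀≢0 : coeff p 0 ≢ 0#
      p₀≢0 p₀≡0 = p≄[] (≃-trans (isConstant⇒≃const p-const) (≃-trans (∷-cong p₀≡0 ≃-refl) (0∷-zero ≃-refl)))

  ∣oneₚ⇒isConstant : ∀ {p} → p ∣ oneₚ → IsConstant p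
  ∣oneₚ⇒isConstant {p} (k , kp≃1) = *ₚ≃oneₚ⇒isConstant {p} {k} (≃-trans (*ₚ-comm p k) kp≃1)

  irreducible⇒≄[] : ∀ {p} → Irreducible p → ¬ p ≃ []
  irreducible⇒≄[] (p-nonconst , _) p≃[] = p-nonconst (IsConstant-resp-≃ (≃-sym p≃[]) (λ _ → refl))

  Irreducible-resp-≃ : ∀ {p q} → p ≃ q → Irreducible p → Irreducible q
  Irreducible-resp-≃ {p} {q} p≃q (p-nonconst , p-split) =
    (λ q-const → p-nonconst (IsConstant-resp-≃ (≃-sym p≃q) q-const)) ,
    (λ a b q≈ab → p-split a b (coeff-≡ (≃-trans p≃q (mk≃ {q} {a *ₚ b} q≈ab))))

  module _ (A B : Pol) where

    InIdeal : Pol → Set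
    InIdeal x = Σ Pol λ u → Σ Pol λ v → x ≃ u *ₚ A +ₚ v *ₚ B

    InIdeal-resp-≃ : ∀ {x y} → x ≃ y → InIdeal x → InIdeal y
    InIdeal-resp-≃ x≃y (u , v , x≃) = u , v , ≃-trans (≃-sym x≃y) x≃

    inIdeal-*ₚ : ∀ w {x} → InIdeal x → InIdeal (w *ₚ x)
    inIdeal-*ₚ w {x} (u , v , x≃) = w *ₚ u , w *ₚ v ,
      ≃-trans (*ₚ-cong (≃-refl {w}) x≃)
              (solve 5 (λ w u v a b → w :* (u :* a :+ v :* b) := w :* u :* a :+ w :* v :* b) ≃-refl w u v A B)

    inIdeal-remainder : ∀ {x y q r} → InIdeal x → InIdeal y → x ≃ q *ₚ y +ₚ r → InIdeal r
    inIdeal-remainder {x} {y} {q} {r} (u , v , x≃) (u′ , v′ , y≃) x≃qy+r =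
      u +ₚ m *ₚ q *ₚ u′ , v +ₚ m *ₚ q *ₚ v′ , (begin
        r
          ≈⟨ +ₚ-identityʳ r ⟨
        r +ₚ []
          ≈⟨ +ₚ-cong (≃-refl {r}) (negₚ-inverseʳ (q *ₚ y)) ⟨
        r +ₚ (q *ₚ y +ₚ negₚ (q *ₚ y))
          ≈⟨ +ₚ-cong (≃-refl {r}) (+ₚ-cong (≃-refl {q *ₚ y}) (negₚ≃minusOneₚ*ₚ (q *ₚ y))) ⟩
        r +ₚ (q *ₚ y +ₚ m *ₚ (q *ₚ y))
          ≈⟨ solve 3 (λ r z m → r :+ (z :+ m :* z) := (z :+ r) :+ m :* z) ≃-refl r (q *ₚ y) m ⟩
        (q *ₚ y +ₚ r) +ₚ m *ₚ (q *ₚ y)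
          ≈⟨ +ₚ-cong x≃qy+r (≃-refl {m *ₚ (q *ₚ y)}) ⟨
        x +ₚ m *ₚ (q *ₚ y)
          ≈⟨ +ₚ-cong x≃ (*ₚ-cong (≃-refl {m}) (*ₚ-cong (≃-refl {q}) y≃)) ⟩
        (u *ₚ A +ₚ v *ₚ B) +ₚ m *ₚ (q *ₚ (u′ *ₚ A +ₚ v′ *ₚ B))
          ≈⟨ solve 8 (λ u v u′ v′ q m a b → (u :* a :+ v :* b) :+ m :* (q :* (u′ :* a :+ v′ :* b))
                                          := (u :+ m :* q :* u′) :* a :+ (v :+ m :* q :* v′) :* b)
                     ≃-refl u v u′ v′ q m A B ⟩
        (u +ₚ m *ₚ q *ₚ u′) *ₚ A +ₚ (v +ₚ m *ₚ q *ₚ v′) *ₚ B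
          ∎)
      where
        open ≃-Reasoning
        m : Pol
        m = minusOneₚ

    oneₚ-inIdeal : ∀ {x} → InIdeal x → x ∣ oneₚ → InIdeal oneₚ
    oneₚ-inIdeal x∈ (w , wx≃1) = InIdeal-resp-≃ wx≃1 (inIdeal-*ₚ w x∈)

    A-inIdeal : InIdeal A
    A-inIdeal = oneₚ , [] , ≃-sym (≃-trans (+ₚ-identityʳ _) (*ₚ-identityˡ A))

    B-inIdeal : InIdeal B
    B-inIdeal = [] , oneₚ , ≃-sym (*ₚ-identityˡ B)

    commonDivisor : ∀ n {x y} → InIdeal x → InIdeal y → DegreeBelow y n →
                    Σ Pol λ g → InIdeal g × g ∣ x × g ∣ y
    commonDivisor zero {x} {y} x∈ y∈ y<0 =
      x , x∈ , ∣ʳ-refl , ∣ʳ-respʳ-≈ (≃-sym (degreeBelow0⇒≃[] y<0)) (x ∣0)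
    commonDivisor (suc n) {x} {y} x∈ y∈ y<n with ≃[]⊎hasDegree y
    ... | inj₁ y≃[] = x , x∈ , ∣ʳ-refl , ∣ʳ-respʳ-≈ (≃-sym y≃[]) (x ∣0)
    ... | inj₂ (m , y°) with divMod y° x
    ...   | q , r , x≃qy+r , r<m
      with commonDivisor n y∈ (inIdeal-remainder {q = q} x∈ y∈ x≃qy+r)
                           (DegreeBelow-mono (ℕₚ.≤-pred (hasDegree⇒< y° y<n)) r<m)
    ...     | g , g∈ , g∣y , g∣r =
      g , g∈ , ∣ʳ-respʳ-≈ (≃-sym x≃qy+r) (∣-+ₚ (x∣ʳy⇒x∣ʳzy q g∣y) g∣r) , g∣y

  irreducible⇒∣⊎coprime : ∀ {Q} B → Irreducible Q → Q ∣ B ⊎ InIdeal Q B oneₚ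
  irreducible⇒∣⊎coprime {Q} B Q-irr@(_ , Q-split)
    with commonDivisor Q B (length B) (A-inIdeal Q B) (B-inIdeal Q B) (degreeBelow-length B)
  ... | g , g∈ , (k , kg≃Q) , g∣B with Q-split k g (coeff-≡ (≃-sym kg≃Q))
  ...   | inj₁ k-const = inj₁ (∣ʳ-trans Q∣g g∣B)
    where
      k≄[] : ¬ k ≃ []
      k≄[] k≃[] = irreducible⇒≄[] Q-irr (≃-trans (≃-sym kg≃Q) (*ₚ-zeroˡ g k≃[]))
      Q∣g : Q ∣ g
      Q∣g with nonzeroConstant∣oneₚ k-const k≄[]
      ... | w , wk≃1 = w , (begin
        w *ₚ Q          ≈⟨ *ₚ-cong (≃-refl {w}) kg≃Q ⟨
        w *ₚ (k *ₚ g)   ≈⟨ *ₚ-assoc w k g ⟨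
        w *ₚ k *ₚ g     ≈⟨ *ₚ-cong wk≃1 (≃-refl {g}) ⟩
        oneₚ *ₚ g       ≈⟨ *ₚ-identityˡ g ⟩
        g               ∎)
        where open ≃-Reasoning
  ...   | inj₂ g-const = inj₂ (oneₚ-inIdeal Q B g∈ (nonzeroConstant∣oneₚ g-const g≄[]))
    where
      g≄[] : ¬ g ≃ []
      g≄[] g≃[] = irreducible⇒≄[] Q-irr (≃-trans (≃-sym kg≃Q) (≃-trans (*ₚ-cong (≃-refl {k}) g≃[]) (*ₚ-zeroʳ k)))

  irreducible⇒prime : ∀ {Q} → Irreducible Q → Prime Q
  irreducible⇒prime {Q} Q-irr =
    mkPrime (irreducible⇒≄[] Q-irr) (λ Q∣1 → proj₁ Q-irr (∣oneₚ⇒isConstant Q∣1)) split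
    where
      split : ∀ {B C} → Q ∣ B *ₚ C → Q ∣ B ⊎ Q ∣ C
      split {B} {C} Q∣BC with irreducible⇒∣⊎coprime B Q-irr
      ... | inj₁ Q∣B = inj₁ Q∣B
      ... | inj₂ (u , v , 1≃uQ+vB) =
        inj₂ (∣ʳ-respʳ-≈ C≃ (∣-+ₚ (u *ₚ C , ≃-refl) (x∣ʳy⇒x∣ʳzy v Q∣BC)))
        where
          C≃ : u *ₚ C *ₚ Q +ₚ v *ₚ (B *ₚ C) ≃ C
          C≃ = begin
            u *ₚ C *ₚ Q +ₚ v *ₚ (B *ₚ C)
              ≈⟨ solve 5 (λ u v b c q → u :* c :* q :+ v :* (b :* c) := (u :* q :+ v :* b) :* c)
                                                         ≃-refl u v B C Q ⟩
            (u *ₚ Q +ₚ v *ₚ B) *ₚ C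
              ≈⟨ *ₚ-cong 1≃uQ+vB (≃-refl {C}) ⟨
            oneₚ *ₚ C
              ≈⟨ *ₚ-identityˡ C ⟩
            C
              ∎
            where open ≃-Reasoning

module Derivative (F : FiniteField) where
  open FiniteField F
  open Poly F
  open Euclid F public
  open PolynomialSolver using (solve; _:=_; _:+_; _:*_)

  coeff-derivAux : ∀ k p n → coeff (derivAux k p) n ≡ fromℕ (k ℕ.+ n) * coeff p n
  coeff-derivAux k []      n       = sym (zeroʳ _)
  coeff-derivAux k (a ∷ p) zero    = cong (λ m → fromℕ m * a) (sym (ℕₚ.+-identityʳ k))
  coeff-derivAux k (a ∷ p) (suc n) =
    trans (coeff-derivAux (suc k) p n) (cong (λ m → fromℕ m * coeff p n) (sym (ℕₚ.+-suc k n)))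

  coeff-deriv : ∀ p n → coeff (deriv p) n ≡ fromℕ (suc n) * coeff p (suc n)
  coeff-deriv []      n = sym (zeroʳ _)
  coeff-deriv (a ∷ p) n = coeff-derivAux 1 p n

  deriv-cong : ∀ {p q} → p ≃ q → deriv p ≃ deriv q
  deriv-cong {p} {q} (mk≃ e) = mk≃ λ n →
    trans (coeff-deriv p n) (trans (cong (fromℕ (suc n) *_) (e (suc n))) (sym (coeff-deriv q n)))

  deriv-+ₚ : ∀ p q → deriv (p +ₚ q) ≃ deriv p +ₚ deriv q
  deriv-+ₚ p q = mk≃ λ n → begin
    coeff (deriv (p +ₚ q)) n                              ≡⟨ coeff-deriv (p +ₚ q) n ⟩
    fromℕ (suc n) * coeff (p +ₚ q) (suc n)                ≡⟨ cong (fromℕ (suc n) *_) (coeff-+ₚ p q (suc n)) ⟩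
    fromℕ (suc n) * (coeff p (suc n) + coeff q (suc n))   ≡⟨ distribˡ _ _ _ ⟩
    fromℕ (suc n) * coeff p (suc n) + fromℕ (suc n) * coeff q (suc n)
                                                          ≡⟨ cong₂ _+_ (coeff-deriv p n) (coeff-deriv q n) ⟨
    coeff (deriv p) n + coeff (deriv q) n                 ≡⟨ coeff-+ₚ (deriv p) (deriv q) n ⟨
    coeff (deriv p +ₚ deriv q) n                          ∎
    where open ≡-Reasoning

  deriv-scale : ∀ a p → deriv (scale a p) ≃ scale a (deriv p)
  deriv-scale a p = mk≃ λ n → begin
    coeff (deriv (scale a p)) n
      ≡⟨ coeff-deriv (scale a p) n ⟩
    fromℕ (suc n) * coeff (scale a p) (suc n)
      ≡⟨ cong (fromℕ (suc n) *_) (coeff-scale a p (suc n)) ⟩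
    fromℕ (suc n) * (a * coeff p (suc n))
      ≡⟨ CoefficientSolver.solve 3 (λ x y z → x ⊗ (y ⊗ z) ⊜ y ⊗ (x ⊗ z))
                                                     refl (fromℕ (suc n)) a (coeff p (suc n)) ⟩
    a * (fromℕ (suc n) * coeff p (suc n))
      ≡⟨ cong (a *_) (coeff-deriv p n) ⟨
    a * coeff (deriv p) n
      ≡⟨ coeff-scale a (deriv p) n ⟨
    coeff (scale a (deriv p)) n
      ∎
    where
      open ≡-Reasoning
      open CoefficientSolver using () renaming (_:*_ to _⊗_; _:=_ to _⊜_)

  deriv-∷ : ∀ a p → deriv (a ∷ p) ≃ p +ₚ (0# ∷ deriv p)
  deriv-∷ a p = mk≃ λ n → begin
    coeff (deriv (a ∷ p)) n                  ≡⟨ coeff-deriv (a ∷ p) n ⟩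
    (1# + fromℕ n) * coeff p n               ≡⟨ distribʳ _ 1# (fromℕ n) ⟩
    1# * coeff p n + fromℕ n * coeff p n     ≡⟨ cong₂ _+_ (*-identityˡ _) (shifted n) ⟩
    coeff p n + coeff (0# ∷ deriv p) n       ≡⟨ coeff-+ₚ p (0# ∷ deriv p) n ⟨
    coeff (p +ₚ (0# ∷ deriv p)) n            ∎
    where
      open ≡-Reasoning
      shifted : ∀ n → fromℕ n * coeff p n ≡ coeff (0# ∷ deriv p) n
      shifted zero    = zeroˡ _
      shifted (suc m) = sym (coeff-deriv p m)

  deriv-*ₚ : ∀ p q → deriv (p *ₚ q) ≃ deriv p *ₚ q +ₚ p *ₚ deriv q
  deriv-*ₚ []      q = ≃-refl
  deriv-*ₚ (a ∷ p) q = begin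
    deriv (scale a q +ₚ (0# ∷ p *ₚ q))
      ≈⟨ deriv-+ₚ (scale a q) (0# ∷ p *ₚ q) ⟩
    deriv (scale a q) +ₚ deriv (0# ∷ p *ₚ q)
      ≈⟨ +ₚ-cong (deriv-scale a q) (deriv-∷ 0# (p *ₚ q)) ⟩
    scale a (deriv q) +ₚ (p *ₚ q +ₚ (0# ∷ deriv (p *ₚ q)))
      ≈⟨ +ₚ-cong (≃-refl {scale a (deriv q)}) (+ₚ-cong (≃-refl {p *ₚ q}) (∷-cong (sym (+-identityˡ 0#)) (deriv-*ₚ p q))) ⟩
    scale a (deriv q) +ₚ (p *ₚ q +ₚ ((0# ∷ deriv p *ₚ q) +ₚ (0# ∷ p *ₚ deriv q)))
      ≈⟨ solve 4 (λ s x y z → s :+ (x :+ (y :+ z)) := (x :+ y) :+ (s :+ z)) ≃-refl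
               (scale a (deriv q)) (p *ₚ q) (0# ∷ deriv p *ₚ q) (0# ∷ p *ₚ deriv q) ⟩
    (p *ₚ q +ₚ (0# ∷ deriv p *ₚ q)) +ₚ (a ∷ p) *ₚ deriv q
      ≈⟨ +ₚ-cong (≃-trans (*ₚ-distribʳ q p (0# ∷ deriv p)) (+ₚ-cong (≃-refl {p *ₚ q}) (0∷-*ₚ (deriv p) q)))
                 (≃-refl {(a ∷ p) *ₚ deriv q}) ⟨
    (p +ₚ (0# ∷ deriv p)) *ₚ q +ₚ (a ∷ p) *ₚ deriv q
      ≈⟨ +ₚ-cong (*ₚ-cong (deriv-∷ a p) (≃-refl {q})) (≃-refl {(a ∷ p) *ₚ deriv q}) ⟨
    deriv (a ∷ p) *ₚ q +ₚ (a ∷ p) *ₚ deriv q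
      ∎
    where open ≃-Reasoning

  Separable-resp-≃ : ∀ {p q} → p ≃ q → Separable p → Separable q
  Separable-resp-≃ {p} {q} p≃q (u , v , bezout) = u , v , coeff-≡ (begin
    u *ₚ q +ₚ v *ₚ deriv q   ≈⟨ +ₚ-cong (*ₚ-cong (≃-refl {u}) p≃q) (*ₚ-cong (≃-refl {v}) (deriv-cong p≃q)) ⟨
    u *ₚ p +ₚ v *ₚ deriv p   ≈⟨ mk≃ bezout ⟩
    oneₚ                     ∎)
    where open ≃-Reasoning

  separable-*ₚʳ : ∀ A B → Separable (A *ₚ B) → Separable B
  separable-*ₚʳ A B (u , v , bezout) = u *ₚ A +ₚ v *ₚ deriv A , v *ₚ A , coeff-≡ (begin
    (u *ₚ A +ₚ v *ₚ deriv A) *ₚ B +ₚ v *ₚ A *ₚ deriv B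
      ≈⟨ solve 6 (λ u v a da b db → (u :* a :+ v :* da) :* b :+ v :* a :* db
                                   := u :* (a :* b) :+ v :* (da :* b :+ a :* db))
               ≃-refl u v A (deriv A) B (deriv B) ⟩
    u *ₚ (A *ₚ B) +ₚ v *ₚ (deriv A *ₚ B +ₚ A *ₚ deriv B)
      ≈⟨ +ₚ-cong (≃-refl {u *ₚ (A *ₚ B)}) (*ₚ-cong (≃-refl {v}) (deriv-*ₚ A B)) ⟨
    u *ₚ (A *ₚ B) +ₚ v *ₚ deriv (A *ₚ B)
      ≈⟨ mk≃ bezout ⟩
    oneₚ ∎)
    where open ≃-Reasoning

  -- A² ∣ p gives A ∣ p and A ∣ p′, so A divides the Bézout combination 1.
  separable⇒squarefree : ∀ {p} A → Separable p → A *ₚ A ∣ p → IsConstant A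
  separable⇒squarefree {p} A (u , v , bezout) (K , K[AA]≃p) = ∣oneₚ⇒isConstant (X , (begin
    X *ₚ A
      ≈⟨ solve 6 (λ u v k a dka da → (u :* (k :* a) :+ v :* (dka :+ k :* da)) :* a
                                    := u :* (k :* a :* a) :+ v :* (dka :* a :+ k :* a :* da))
               ≃-refl u v K A (deriv (K *ₚ A)) (deriv A) ⟩
    u *ₚ (K *ₚ A *ₚ A) +ₚ v *ₚ (deriv (K *ₚ A) *ₚ A +ₚ K *ₚ A *ₚ deriv A)
      ≈⟨ +ₚ-cong (*ₚ-cong (≃-refl {u}) KAA≃p) (*ₚ-cong (≃-refl {v}) p′≃) ⟩
    u *ₚ p +ₚ v *ₚ deriv p
      ≈⟨ mk≃ bezout ⟩
    oneₚ
      ∎))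
    where
      open ≃-Reasoning
      X : Pol
      X = u *ₚ (K *ₚ A) +ₚ v *ₚ (deriv (K *ₚ A) +ₚ K *ₚ deriv A)
      KAA≃p : K *ₚ A *ₚ A ≃ p
      KAA≃p = ≃-trans (*ₚ-assoc K A A) K[AA]≃p
      p′≃ : deriv (K *ₚ A) *ₚ A +ₚ K *ₚ A *ₚ deriv A ≃ deriv p
      p′≃ = ≃-trans (≃-sym (deriv-*ₚ (K *ₚ A) A)) (deriv-cong KAA≃p)

module Monic (F : FiniteField) where
  open FiniteField F
  open Poly F
  open Derivative F public

  IsMonic : Pol → ℕ → Set
  IsMonic p d = DegreeBelow p (suc d) × coeff p d ≡ 1#

  isMonic⇒hasDegree : ∀ {p d} → IsMonic p d → HasDegree p d
  isMonic⇒hasDegree (p<d , lead≡1) = (λ lead≡0 → 0≢1 (trans (sym lead≡0) lead≡1)) , p<d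

  monic-isMonic : ∀ {d} (v : Vec Carrier d) → IsMonic (monic v) d
  monic-isMonic V.[]       = degreeBelow (λ where (suc k) _ → refl) , refl
  monic-isMonic (a V.∷ v) with monic-isMonic v
  ... | v<d , lead≡1 = degreeBelow (λ where (suc k) (s≤s d<k) → coeff-≥ v<d k d<k) , lead≡1

  monic-injective : ∀ {d} {v w : Vec Carrier d} → monic v ≃ monic w → v ≡ w
  monic-injective {v = V.[]}    {V.[]}    _ = refl
  monic-injective {v = a V.∷ v} {b V.∷ w} e = cong₂ V._∷_ (∷-injectiveˡ e) (monic-injective (∷-injectiveʳ e))

  coeffVec : ∀ d → Pol → Vec Carrier d
  coeffVec zero    _       = V.[]
  coeffVec (suc d) []      = 0# V.∷ coeffVec d []
  coeffVec (suc d) (a ∷ p) = a V.∷ coeffVec d p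

  monic-coeffVec : ∀ {p} d → IsMonic p d → monic (coeffVec d p) ≃ p
  monic-coeffVec {p}     zero    (p<1 , p₀≡1) =
    ≃-sym (≃-trans (isConstant⇒≃const (degreeBelow1⇒isConstant {p} p<1)) (∷-cong p₀≡1 ≃-refl))
  monic-coeffVec {[]}    (suc d) (_ , 0≡1)      = contradiction 0≡1 0≢1
  monic-coeffVec {a ∷ p} (suc d) (p<d , lead≡1) =
    ∷-cong refl (monic-coeffVec d (tail-degreeBelow p<d , lead≡1))

  irreducible-monic-∣⇒≃ : ∀ {P Q d e} → Irreducible P → Irreducible Q → IsMonic P d → IsMonic Q e →
                          Q ∣ P → Q ≃ P
  irreducible-monic-∣⇒≃ {P} {Q} {d} {e} (_ , P-split) (Q-nonconst , _) P-monic Q-monic (k , kQ≃P)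
    with P-split k Q (coeff-≡ (≃-sym kQ≃P))
  ... | inj₂ Q-const = contradiction Q-const Q-nonconst
  ... | inj₁ k-const = ≃-trans (≃-sym (*ₚ-identityˡ Q)) (≃-trans (*ₚ-cong (≃-sym k≃1) (≃-refl {Q})) kQ≃P)
    where
      κ : Carrier
      κ = coeff k 0
      κ≢0 : κ ≢ 0#
      κ≢0 κ≡0 = hasDegree⇒≄[] (isMonic⇒hasDegree P-monic) (≃-trans (≃-sym kQ≃P) (*ₚ-zeroˡ Q k≃[]))
        where
          k≃[] : k ≃ []
          k≃[] = ≃-trans (isConstant⇒≃const {k} k-const) (≃-trans (∷-cong κ≡0 (≃-refl {[]})) (0∷-zero ≃-refl))
      k-degree : HasDegree k 0
      k-degree = κ≢0 , isConstant⇒degreeBelow1 {k} k-const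
      kQ-degree : HasDegree (k *ₚ Q) e
      kQ-degree = hasDegree-*ₚ {k} {Q} k-degree (isMonic⇒hasDegree Q-monic)
      d≡e : d ≡ e
      d≡e = hasDegree-unique (isMonic⇒hasDegree P-monic) (HasDegree-resp-≃ kQ≃P kQ-degree)
      κ≡1 : κ ≡ 1#
      κ≡1 = begin
        κ                         ≡⟨ *-identityʳ κ ⟨
        κ * 1#                    ≡⟨ cong (κ *_) (proj₂ Q-monic) ⟨
        κ * coeff Q e             ≡⟨ coeff-*ₚ-top 0 e (proj₂ k-degree) (proj₁ Q-monic) ⟨
        coeff (k *ₚ Q) e          ≡⟨ coeff-≡ kQ≃P e ⟩
        coeff P e                 ≡⟨ cong (coeff P) d≡e ⟨
        coeff P d                 ≡⟨ proj₂ P-monic ⟩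
        1#                        ∎
        where open ≡-Reasoning
      k≃1 : k ≃ oneₚ
      k≃1 = ≃-trans (isConstant⇒≃const {k} k-const) (∷-cong κ≡1 ≃-refl)

module Reversal (F : FiniteField) (λ₀ : FiniteField.Carrier F) where
  open FiniteField F
  open Poly F
  open Monic F public

  ^-+ : ∀ x m n → x ^ m * x ^ n ≡ x ^ (m ℕ.+ n)
  ^-+ x zero    n = *-identityˡ _
  ^-+ x (suc m) n = trans (*-assoc _ _ _) (cong (x *_) (^-+ x m n))

  ^-≢0 : ∀ {x} k → x ≢ 0# → x ^ k ≢ 0#
  ^-≢0 zero    x≢0 1≡0 = 0≢1 (sym 1≡0)
  ^-≢0 (suc k) x≢0     = *-≢0 x≢0 (^-≢0 k x≢0)

  shift : ℕ → Pol → Pol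
  shift zero    p = p
  shift (suc k) p = 0# ∷ shift k p

  shift-cong : ∀ k {p q} → p ≃ q → shift k p ≃ shift k q
  shift-cong zero    p≃q = p≃q
  shift-cong (suc k) p≃q = ∷-cong refl (shift-cong k p≃q)

  shift-*ₚ : ∀ k p q → shift k p *ₚ q ≃ shift k (p *ₚ q)
  shift-*ₚ zero    p q = ≃-refl
  shift-*ₚ (suc k) p q = ≃-trans (0∷-*ₚ (shift k p) q) (∷-cong refl (shift-*ₚ k p q))

  scale-shift : ∀ c k p → scale c (shift k p) ≃ shift k (scale c p)
  scale-shift c zero    p = ≃-refl
  scale-shift c (suc k) p = ∷-cong (zeroʳ c) (scale-shift c k p)

  coeff-map-applyUpTo : ∀ (g : ℕ → Carrier) f n {j} → j < n → coeff (map g (applyUpTo f n)) j ≡ g (f j)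
  coeff-map-applyUpTo g f (suc n) {zero}  _         = refl
  coeff-map-applyUpTo g f (suc n) {suc j} (s≤s j<n) = coeff-map-applyUpTo g (f ∘ suc) n j<n

  map-applyUpTo-degreeBelow : ∀ (g : ℕ → Carrier) f n → DegreeBelow (map g (applyUpTo f n)) n
  map-applyUpTo-degreeBelow g f zero    = degreeBelow λ _ _ → refl
  map-applyUpTo-degreeBelow g f (suc n) = degreeBelow λ where
    (suc k) (s≤s n≤k) → coeff-≥ (map-applyUpTo-degreeBelow g (f ∘ suc) n) k n≤k

  reversalCoeff : ℕ → Pol → ℕ → Carrier
  reversalCoeff k p j = coeff p (k ∸ j) * λ₀ ^ (k ∸ j)

  -- X^k p(λ₀/X), the reciprocal before normalising the constant term.
  reversal : ℕ → Pol → Pol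
  reversal k p = map (reversalCoeff k p) (upTo (suc k))

  coeff-reversal : ∀ k p {j} → j ≤ k → coeff (reversal k p) j ≡ reversalCoeff k p j
  coeff-reversal k p j≤k = coeff-map-applyUpTo (reversalCoeff k p) id (suc k) (s≤s j≤k)

  reversal-degreeBelow : ∀ k p → DegreeBelow (reversal k p) (suc k)
  reversal-degreeBelow k p = map-applyUpTo-degreeBelow (reversalCoeff k p) id (suc k)

  reversal-ext : ∀ k p {q} → DegreeBelow q (suc k) →
                 (∀ {j} → j ≤ k → reversalCoeff k p j ≡ coeff q j) → reversal k p ≃ q
  reversal-ext k p {q} q<k agree = mk≃ λ j → case j
    where
      case : ∀ j → coeff (reversal k p) j ≡ coeff q j
      case j with j ℕₚ.≤? k
      ... | yes j≤k = trans (coeff-reversal k p j≤k) (agree j≤k)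
      ... | no  j≰k = trans (coeff-≥ (reversal-degreeBelow k p) j (ℕₚ.≰⇒> j≰k))
                            (sym (coeff-≥ q<k j (ℕₚ.≰⇒> j≰k)))

  reversal-cong : ∀ {k p q} → p ≃ q → reversal k p ≃ reversal k q
  reversal-cong {k} {p} {q} p≃q = reversal-ext k p (reversal-degreeBelow k q) λ {j} j≤k →
    trans (cong (_* λ₀ ^ (k ∸ j)) (coeff-≡ p≃q (k ∸ j))) (sym (coeff-reversal k q j≤k))

  reversal-+ₚ : ∀ k p q → reversal k (p +ₚ q) ≃ reversal k p +ₚ reversal k q
  reversal-+ₚ k p q =
    reversal-ext k (p +ₚ q) (+ₚ-degreeBelow (reversal-degreeBelow k p) (reversal-degreeBelow k q)) λ {j} j≤k → begin
    coeff (p +ₚ q) (k ∸ j) * λ₀ ^ (k ∸ j)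
      ≡⟨ cong (_* λ₀ ^ (k ∸ j)) (coeff-+ₚ p q (k ∸ j)) ⟩
    (coeff p (k ∸ j) + coeff q (k ∸ j)) * λ₀ ^ (k ∸ j)
      ≡⟨ distribʳ _ _ _ ⟩
    reversalCoeff k p j + reversalCoeff k q j
      ≡⟨ cong₂ _+_ (coeff-reversal k p j≤k) (coeff-reversal k q j≤k) ⟨
    coeff (reversal k p) j + coeff (reversal k q) j
      ≡⟨ coeff-+ₚ (reversal k p) (reversal k q) j ⟨
    coeff (reversal k p +ₚ reversal k q) j
      ∎
    where open ≡-Reasoning

  reversal-scale : ∀ k c p → reversal k (scale c p) ≃ scale c (reversal k p)
  reversal-scale k c p =
    reversal-ext k (scale c p) (scale-degreeBelow c (reversal-degreeBelow k p)) λ {j} j≤k → begin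
    coeff (scale c p) (k ∸ j) * λ₀ ^ (k ∸ j)     ≡⟨ cong (_* λ₀ ^ (k ∸ j)) (coeff-scale c p (k ∸ j)) ⟩
    c * coeff p (k ∸ j) * λ₀ ^ (k ∸ j)           ≡⟨ *-assoc _ _ _ ⟩
    c * reversalCoeff k p j                      ≡⟨ cong (c *_) (coeff-reversal k p j≤k) ⟨
    c * coeff (reversal k p) j                   ≡⟨ coeff-scale c (reversal k p) j ⟨
    coeff (scale c (reversal k p)) j             ∎
    where open ≡-Reasoning

  reversal-[] : ∀ k → reversal k [] ≃ []
  reversal-[] k = reversal-ext k [] (degreeBelow λ _ _ → refl) λ _ → zeroˡ _

  reversal-suc : ∀ {k b} → DegreeBelow b (suc k) → reversal (suc k) b ≃ 0# ∷ reversal k b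
  reversal-suc {k} {b} b<k = reversal-ext (suc k) b shifted<k agree
    where
      shifted<k : DegreeBelow (0# ∷ reversal k b) (suc (suc k))
      shifted<k = degreeBelow λ where (suc j) (s≤s k<j) → coeff-≥ (reversal-degreeBelow k b) j k<j
      agree : ∀ {j} → j ≤ suc k → reversalCoeff (suc k) b j ≡ coeff (0# ∷ reversal k b) j
      agree {zero}  _         = trans (cong (_* λ₀ ^ suc k) (coeff-≥ b<k (suc k) ℕₚ.≤-refl)) (zeroˡ _)
      agree {suc j} (s≤s j≤k) = sym (coeff-reversal k b j≤k)

  reversal-shift : ∀ k {n b} → DegreeBelow b (suc n) → reversal (k ℕ.+ n) b ≃ shift k (reversal n b)
  reversal-shift zero            b<n = ≃-refl
  reversal-shift (suc k) {n} {b} b<n =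
    ≃-trans (reversal-suc (DegreeBelow-mono (s≤s (ℕₚ.m≤n+m n k)) b<n)) (∷-cong refl (reversal-shift k b<n))

  reversal-0∷ : ∀ k q → reversal (suc k) (0# ∷ q) ≃ scale λ₀ (reversal k q)
  reversal-0∷ k q =
    reversal-ext (suc k) (0# ∷ q) (scale-degreeBelow λ₀ (DegreeBelow-mono (ℕₚ.n≤1+n _) (reversal-degreeBelow k q))) agree
    where
      open ≡-Reasoning
      agree : ∀ {j} → j ≤ suc k → reversalCoeff (suc k) (0# ∷ q) j ≡ coeff (scale λ₀ (reversal k q)) j
      agree {j} j≤1+k with ℕₚ.m≤n⇒m<n∨m≡n j≤1+k
      ... | inj₂ refl = begin
        coeff (0# ∷ q) (suc k ∸ suc k) * λ₀ ^ (suc k ∸ suc k)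
          ≡⟨ cong (λ i → coeff (0# ∷ q) i * λ₀ ^ i) (ℕₚ.n∸n≡0 k) ⟩
        0# * λ₀ ^ 0
          ≡⟨ zeroˡ _ ⟩
        0#
          ≡⟨ zeroʳ λ₀ ⟨
        λ₀ * 0#
          ≡⟨ cong (λ₀ *_) (coeff-≥ (reversal-degreeBelow k q) (suc k) ℕₚ.≤-refl) ⟨
        λ₀ * coeff (reversal k q) (suc k)
          ≡⟨ coeff-scale λ₀ (reversal k q) (suc k) ⟨
        coeff (scale λ₀ (reversal k q)) (suc k)
          ∎
      ... | inj₁ (s≤s j≤k) = begin
        coeff (0# ∷ q) (suc k ∸ j) * λ₀ ^ (suc k ∸ j)
          ≡⟨ cong (λ i → coeff (0# ∷ q) i * λ₀ ^ i) (ℕₚ.+-∸-assoc 1 j≤k) ⟩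
        coeff q (k ∸ j) * (λ₀ * λ₀ ^ (k ∸ j))
          ≡⟨ CoefficientSolver.solve 3 (λ x y z → x ⊗ (y ⊗ z) ⊜ y ⊗ (x ⊗ z)) refl _ _ _ ⟩
        λ₀ * reversalCoeff k q j
          ≡⟨ cong (λ₀ *_) (coeff-reversal k q j≤k) ⟨
        λ₀ * coeff (reversal k q) j
          ≡⟨ coeff-scale λ₀ (reversal k q) j ⟨
        coeff (scale λ₀ (reversal k q)) j
          ∎
        where open CoefficientSolver using () renaming (_:*_ to _⊗_; _:=_ to _⊜_)

  reversal-const : ∀ k c → reversal k (c ∷ []) ≃ shift k (c ∷ [])
  reversal-const zero    c = ∷-cong (*-identityʳ c) ≃-refl
  reversal-const (suc k) c = ≃-trans (reversal-suc const<k) (∷-cong refl (reversal-const k c))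
    where
      const<k : DegreeBelow (c ∷ []) (suc k)
      const<k = degreeBelow λ where (suc j) _ → refl

  reversal-∷ : ∀ m c a → reversal (suc m) (c ∷ a) ≃ shift (suc m) (c ∷ []) +ₚ scale λ₀ (reversal m a)
  reversal-∷ m c a = begin
    reversal (suc m) (c ∷ a)
      ≈⟨ reversal-cong (∷-cong (sym (+-identityʳ c)) (≃-refl {a})) ⟩
    reversal (suc m) ((c ∷ []) +ₚ (0# ∷ a))
      ≈⟨ reversal-+ₚ (suc m) (c ∷ []) (0# ∷ a) ⟩
    reversal (suc m) (c ∷ []) +ₚ reversal (suc m) (0# ∷ a)
      ≈⟨ +ₚ-cong (reversal-const (suc m) c) (reversal-0∷ m a) ⟩
    shift (suc m) (c ∷ []) +ₚ scale λ₀ (reversal m a)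
      ∎
    where open ≃-Reasoning

  reversal-*ₚ : ∀ {a b} m n → DegreeBelow a (suc m) → DegreeBelow b (suc n) →
                reversal (m ℕ.+ n) (a *ₚ b) ≃ reversal m a *ₚ reversal n b
  reversal-*ₚ {[]}    {b} m n _ _ =
    ≃-trans (reversal-[] (m ℕ.+ n)) (≃-sym (*ₚ-zeroˡ (reversal n b) (reversal-[] m)))
  reversal-*ₚ {c ∷ a} {b} zero n a<1 b<n = begin
    reversal n ((c ∷ a) *ₚ b)             ≈⟨ reversal-cong (*ₚ-congʳ b c∷a≃c) ⟩
    reversal n ((c ∷ []) *ₚ b)            ≈⟨ reversal-cong (const-*ₚ c b) ⟩
    reversal n (scale c b)                ≈⟨ reversal-scale n c b ⟩
    scale c (reversal n b)                ≈⟨ const-*ₚ c (reversal n b) ⟨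
    (c ∷ []) *ₚ reversal n b              ≈⟨ *ₚ-congʳ (reversal n b) (reversal-const 0 c) ⟨
    reversal 0 (c ∷ []) *ₚ reversal n b   ≈⟨ *ₚ-congʳ (reversal n b) (reversal-cong {0} c∷a≃c) ⟨
    reversal 0 (c ∷ a) *ₚ reversal n b    ∎
    where
      open ≃-Reasoning
      c∷a≃c : c ∷ a ≃ c ∷ []
      c∷a≃c = ∷-cong refl (degreeBelow0⇒≃[] (tail-degreeBelow a<1))
  reversal-*ₚ {c ∷ a} {b} (suc m) n a<m b<n = begin
    reversal (suc m ℕ.+ n) (scale c b +ₚ (0# ∷ a *ₚ b))
      ≈⟨ reversal-+ₚ (suc m ℕ.+ n) (scale c b) (0# ∷ a *ₚ b) ⟩
    reversal (suc m ℕ.+ n) (scale c b) +ₚ reversal (suc (m ℕ.+ n)) (0# ∷ a *ₚ b)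
      ≈⟨ +ₚ-cong (reversal-scale (suc m ℕ.+ n) c b) (reversal-0∷ (m ℕ.+ n) (a *ₚ b)) ⟩
    scale c (reversal (suc m ℕ.+ n) b) +ₚ scale λ₀ (reversal (m ℕ.+ n) (a *ₚ b))
      ≈⟨ +ₚ-cong (≃-trans (scale-cong refl (reversal-shift (suc m) b<n)) (scale-shift c (suc m) b̃))
                 (scale-cong refl (reversal-*ₚ m n (tail-degreeBelow a<m) b<n)) ⟩
    shift (suc m) (scale c b̃) +ₚ scale λ₀ (reversal m a *ₚ b̃)
      ≈⟨ +ₚ-cong (≃-trans (shift-*ₚ (suc m) (c ∷ []) b̃) (shift-cong (suc m) (const-*ₚ c b̃)))
                 (scale-*ₚ λ₀ (reversal m a) b̃) ⟨
    shift (suc m) (c ∷ []) *ₚ b̃ +ₚ scale λ₀ (reversal m a) *ₚ b̃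
      ≈⟨ *ₚ-distribʳ b̃ (shift (suc m) (c ∷ [])) (scale λ₀ (reversal m a)) ⟨
    (shift (suc m) (c ∷ []) +ₚ scale λ₀ (reversal m a)) *ₚ b̃
      ≈⟨ *ₚ-congʳ b̃ (reversal-∷ m c a) ⟨
    reversal (suc m) (c ∷ a) *ₚ b̃
      ∎
    where
      open ≃-Reasoning
      b̃ : Pol
      b̃ = reversal n b

  reversal-involutive : ∀ k {p} → DegreeBelow p (suc k) → reversal k (reversal k p) ≃ scale (λ₀ ^ k) p
  reversal-involutive k {p} p<k =
    reversal-ext k (reversal k p) (scale-degreeBelow (λ₀ ^ k) p<k) λ {j} j≤k → begin
    coeff (reversal k p) (k ∸ j) * λ₀ ^ (k ∸ j)
      ≡⟨ cong (_* λ₀ ^ (k ∸ j)) (coeff-reversal k p (ℕₚ.m∸n≤m k j)) ⟩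
    coeff p (k ∸ (k ∸ j)) * λ₀ ^ (k ∸ (k ∸ j)) * λ₀ ^ (k ∸ j)
      ≡⟨ cong (λ i → coeff p i * λ₀ ^ i * λ₀ ^ (k ∸ j)) (ℕₚ.m∸[m∸n]≡n j≤k) ⟩
    coeff p j * λ₀ ^ j * λ₀ ^ (k ∸ j)
      ≡⟨ *-assoc _ _ _ ⟩
    coeff p j * (λ₀ ^ j * λ₀ ^ (k ∸ j))
      ≡⟨ cong (coeff p j *_) (trans (^-+ λ₀ j (k ∸ j)) (cong (λ₀ ^_) (ℕₚ.m+[n∸m]≡n j≤k))) ⟩
    coeff p j * λ₀ ^ k
      ≡⟨ *-comm _ _ ⟩
    λ₀ ^ k * coeff p j
      ≡⟨ coeff-scale (λ₀ ^ k) p j ⟨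
    coeff (scale (λ₀ ^ k) p) j
      ∎
    where open ≡-Reasoning

  recip≃scale-reversal : ∀ d p → recip λ₀ d p ≃ scale (coeff p 0 ⁻¹) (reversal d p)
  recip≃scale-reversal d p = go (upTo (suc d))
    where
      go : ∀ js → map (λ j → reversalCoeff d p j * coeff p 0 ⁻¹) js ≃ scale (coeff p 0 ⁻¹) (map (reversalCoeff d p) js)
      go []       = ≃-refl
      go (j ∷ js) = ∷-cong (*-comm _ _) (go js)

module Reciprocal (F : FiniteField) (λ₀ : FiniteField.Carrier F) (λ₀≢0 : λ₀ ≢ FiniteField.0# F) where
  open FiniteField F
  open Poly F
  open Reversal F λ₀ public

  Reversible : Pol → ℕ → Set
  Reversible p d = IsMonic p d × coeff p 0 ≢ 0#

  recip-cong : ∀ d {p q} → p ≃ q → recip λ₀ d p ≃ recip λ₀ d q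
  recip-cong d {p} {q} p≃q = ≃-trans (recip≃scale-reversal d p)
    (≃-trans (scale-cong (cong _⁻¹ (coeff-≡ p≃q 0)) (reversal-cong p≃q)) (≃-sym (recip≃scale-reversal d q)))

  module _ {p d} (p-rev : Reversible p d) where
    private
      p-monic : IsMonic p d
      p-monic = proj₁ p-rev
      p₀≢0 : coeff p 0 ≢ 0#
      p₀≢0 = proj₂ p-rev
      P̃ : Pol
      P̃ = recip λ₀ d p
      a₀ : Carrier
      a₀ = coeff p 0

    coeff-recip : ∀ {j} → j ≤ d → coeff P̃ j ≡ a₀ ⁻¹ * reversalCoeff d p j
    coeff-recip {j} j≤d = trans (coeff-≡ (recip≃scale-reversal d p) j)
                                (trans (coeff-scale (a₀ ⁻¹) (reversal d p) j) (cong (a₀ ⁻¹ *_) (coeff-reversal d p j≤d)))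

    coeff-recip-0 : coeff P̃ 0 ≡ a₀ ⁻¹ * λ₀ ^ d
    coeff-recip-0 = begin
      coeff P̃ 0                          ≡⟨ coeff-recip z≤n ⟩
      a₀ ⁻¹ * (coeff p d * λ₀ ^ d)       ≡⟨ cong (λ x → a₀ ⁻¹ * (x * λ₀ ^ d)) (proj₂ p-monic) ⟩
      a₀ ⁻¹ * (1# * λ₀ ^ d)              ≡⟨ cong (a₀ ⁻¹ *_) (*-identityˡ _) ⟩
      a₀ ⁻¹ * λ₀ ^ d                     ∎
      where open ≡-Reasoning

    recip-reversible : Reversible P̃ d
    recip-reversible = (P̃<d , P̃-lead≡1) , λ P̃₀≡0 → *-≢0 (⁻¹-≢0 p₀≢0) (^-≢0 d λ₀≢0) (trans (sym coeff-recip-0) P̃₀≡0)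
      where
        P̃<d : DegreeBelow P̃ (suc d)
        P̃<d = DegreeBelow-resp-≃ (≃-sym (recip≃scale-reversal d p)) (scale-degreeBelow (a₀ ⁻¹) (reversal-degreeBelow d p))
        P̃-lead≡1 : coeff P̃ d ≡ 1#
        P̃-lead≡1 = begin
          coeff P̃ d
            ≡⟨ coeff-recip ℕₚ.≤-refl ⟩
          a₀ ⁻¹ * (coeff p (d ∸ d) * λ₀ ^ (d ∸ d))
            ≡⟨ cong (λ i → a₀ ⁻¹ * (coeff p i * λ₀ ^ i)) (ℕₚ.n∸n≡0 d) ⟩
          a₀ ⁻¹ * (a₀ * 1#)
            ≡⟨ cong (a₀ ⁻¹ *_) (*-identityʳ a₀) ⟩
          a₀ ⁻¹ * a₀
            ≡⟨ ⁻¹-inverseˡ p₀≢0 ⟩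
          1#
            ∎
          where open ≡-Reasoning

    reversal-recip : reversal d P̃ ≃ scale (coeff P̃ 0) p
    reversal-recip = begin
      reversal d P̃
        ≈⟨ reversal-cong (recip≃scale-reversal d p) ⟩
      reversal d (scale (a₀ ⁻¹) (reversal d p))
        ≈⟨ reversal-scale d (a₀ ⁻¹) (reversal d p) ⟩
      scale (a₀ ⁻¹) (reversal d (reversal d p))
        ≈⟨ scale-cong refl (reversal-involutive d (proj₁ p-monic)) ⟩
      scale (a₀ ⁻¹) (scale (λ₀ ^ d) p)
        ≈⟨ scale-scale (a₀ ⁻¹) (λ₀ ^ d) p ⟩
      scale (a₀ ⁻¹ * λ₀ ^ d) p
        ≈⟨ scale-cong (sym coeff-recip-0) ≃-refl ⟩
      scale (coeff P̃ 0) p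
        ∎
      where open ≃-Reasoning

    recip-involutive : recip λ₀ d P̃ ≃ p
    recip-involutive = begin
      recip λ₀ d P̃
        ≈⟨ recip≃scale-reversal d P̃ ⟩
      scale (coeff P̃ 0 ⁻¹) (reversal d P̃)
        ≈⟨ scale-cong refl reversal-recip ⟩
      scale (coeff P̃ 0 ⁻¹) (scale (coeff P̃ 0) p)
        ≈⟨ scale-scale _ _ p ⟩
      scale (coeff P̃ 0 ⁻¹ * coeff P̃ 0) p
        ≈⟨ scale-cong (⁻¹-inverseˡ (proj₂ recip-reversible)) ≃-refl ⟩
      scale 1# p
        ≈⟨ scale-identity p ⟩
      p
        ∎
      where open ≃-Reasoning

    recip-factor-reversal : ∀ {a b m n} → HasDegree a m → HasDegree b n → P̃ ≃ a *ₚ b →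
                            p ≃ scale (coeff P̃ 0 ⁻¹) (reversal m a) *ₚ reversal n b
    recip-factor-reversal {a} {b} {m} {n} a° b° P̃≃ab = begin
      p
        ≈⟨ scale-identity p ⟨
      scale 1# p
        ≈⟨ scale-cong (⁻¹-inverseˡ κ≢0) ≃-refl ⟨
      scale (κ ⁻¹ * κ) p
        ≈⟨ scale-scale (κ ⁻¹) κ p ⟨
      scale (κ ⁻¹) (scale κ p)
        ≈⟨ scale-cong refl reversal-recip ⟨
      scale (κ ⁻¹) (reversal d P̃)
        ≈⟨ scale-cong refl (reversal-cong P̃≃ab) ⟩
      scale (κ ⁻¹) (reversal d (a *ₚ b))
        ≈⟨ scale-cong refl (≃-reflexive (cong (λ k → reversal k (a *ₚ b)) m+n≡d)) ⟨
      scale (κ ⁻¹) (reversal (m ℕ.+ n) (a *ₚ b))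
        ≈⟨ scale-cong refl (reversal-*ₚ m n (proj₂ a°) (proj₂ b°)) ⟩
      scale (κ ⁻¹) (reversal m a *ₚ reversal n b)
        ≈⟨ scale-*ₚ (κ ⁻¹) (reversal m a) (reversal n b) ⟨
      scale (κ ⁻¹) (reversal m a) *ₚ reversal n b
        ∎
      where
        open ≃-Reasoning
        κ : Carrier
        κ = coeff P̃ 0
        κ≢0 : κ ≢ 0#
        κ≢0 = proj₂ recip-reversible
        m+n≡d : m ℕ.+ n ≡ d
        m+n≡d = hasDegree-unique (HasDegree-resp-≃ (≃-sym P̃≃ab) (hasDegree-*ₚ a° b°))
                                 (isMonic⇒hasDegree (proj₁ recip-reversible))

  isConstant-scale⁻¹ : ∀ {c} p → c ≢ 0# → IsConstant (scale c p) → IsConstant p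
  isConstant-scale⁻¹ {c} p c≢0 cp-const k = *-cancelˡ-0 c≢0 (trans (sym (coeff-scale c p (suc k))) (cp-const k))

  isConstant-reversal : ∀ {x k} → HasDegree x k → coeff x 0 ≢ 0# → IsConstant (reversal k x) → IsConstant x
  isConstant-reversal {x} {zero}  x° _ _ = degreeBelow1⇒isConstant (proj₂ x°)
  isConstant-reversal {x} {suc m} _ x₀≢0 rev-const = contradiction (begin
    coeff x 0                                           ≡⟨ *-identityʳ _ ⟨
    coeff x 0 * λ₀ ^ 0                                  ≡⟨ cong (λ i → coeff x i * λ₀ ^ i) (ℕₚ.n∸n≡0 m) ⟨
    reversalCoeff (suc m) x (suc m)                     ≡⟨ coeff-reversal (suc m) x ℕₚ.≤-refl ⟨
    coeff (reversal (suc m) x) (suc m)                  ≡⟨ rev-const m ⟩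
    0#                                                  ∎) x₀≢0
    where open ≡-Reasoning

  coeff₀≢0⇒hasDegree : ∀ a → coeff a 0 ≢ 0# → ∃ (HasDegree a)
  coeff₀≢0⇒hasDegree a a₀≢0 with ≃[]⊎hasDegree a
  ... | inj₁ a≃[] = contradiction (coeff-≡ a≃[] 0) a₀≢0
  ... | inj₂ a°   = a°

  coeff₀-*ₚ-≢0 : ∀ a b → coeff (a *ₚ b) 0 ≢ 0# → coeff a 0 ≢ 0# × coeff b 0 ≢ 0#
  coeff₀-*ₚ-≢0 a b ab₀≢0 =
    (λ a₀≡0 → ab₀≢0 (trans (coeff-*ₚ-0 a b) (trans (cong (_* coeff b 0) a₀≡0) (zeroˡ _)))) ,
    (λ b₀≡0 → ab₀≢0 (trans (coeff-*ₚ-0 a b) (trans (cong (coeff a 0 *_) b₀≡0) (zeroʳ _))))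

  -- A factorisation P̃ ≃ a b reverses to p ≃ (κ⁻¹ ã) b̃; as a₀ b₀ = P̃₀ ≠ 0, a constant ã forces deg a = 0.
  recip-irreducible : ∀ {p d} → Reversible p d → Irreducible p → Irreducible (recip λ₀ d p)
  recip-irreducible {p} {d} p-rev (p-nonconst , p-split) = P̃-nonconst , P̃-split
    where
      P̃ : Pol
      P̃ = recip λ₀ d p
      κ≢0 : coeff P̃ 0 ≢ 0#
      κ≢0 = proj₂ (recip-reversible p-rev)

      P̃-nonconst : ¬ IsConstant P̃
      P̃-nonconst P̃-const
        with hasDegree⇒< (isMonic⇒hasDegree (proj₁ (recip-reversible p-rev))) (isConstant⇒degreeBelow1 {P̃} P̃-const)
      ... | s≤s z≤n = p-nonconst (degreeBelow1⇒isConstant (proj₁ (proj₁ p-rev)))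

      P̃-split : ∀ a b → P̃ ≈ₚ a *ₚ b → IsConstant a ⊎ IsConstant b
      P̃-split a b P̃≈ab with coeff₀-*ₚ-≢0 a b (λ ab₀≡0 → κ≢0 (trans (P̃≈ab 0) ab₀≡0))
      ... | a₀≢0 , b₀≢0 with coeff₀≢0⇒hasDegree a a₀≢0 | coeff₀≢0⇒hasDegree b b₀≢0
      ...   | m , a° | n , b°
        with p-split (scale (coeff P̃ 0 ⁻¹) (reversal m a)) (reversal n b)
                     (coeff-≡ (recip-factor-reversal p-rev a° b° (mk≃ P̃≈ab)))
      ...     | inj₁ ã-const =
        inj₁ (isConstant-reversal a° a₀≢0 (isConstant-scale⁻¹ (reversal m a) (⁻¹-≢0 κ≢0) ã-const))
      ...     | inj₂ b̃-const = inj₂ (isConstant-reversal b° b₀≢0 b̃-const)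

length-cartesianProductWith : ∀ {A B C : Set} (f : A → B → C) xs ys →
                              length (cartesianProductWith f xs ys) ≡ length xs ℕ.* length ys
length-cartesianProductWith f []       ys = refl
length-cartesianProductWith f (x ∷ xs) ys = trans (Listₚ.length-++ (map (f x) ys))
  (cong₂ ℕ._+_ (Listₚ.length-map (f x) ys) (length-cartesianProductWith f xs ys))

length-concatMap : ∀ {A B : Set} (f : A → List B) {c} xs → All (λ x → length (f x) ≡ c) xs →
                   length (concatMap f xs) ≡ length xs ℕ.* c
length-concatMap f []       []               = refl
length-concatMap f (x ∷ xs) (fx≡c ∷ fxs≡c) =
  trans (Listₚ.length-++ (f x)) (cong₂ ℕ._+_ fx≡c (length-concatMap f xs fxs≡c))

module DegreeCounts where
  open import Data.Nat using (_*_; _^_; _!)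
  open +-*-Solver using (solve; _:=_; _:+_; _:*_; con)

  infix 4 _∼_
  _∼_ : List ℕ → List ℕ → Set
  xs ∼ ys = ∀ k → countEq k xs ≡ countEq k ys

  countEq-here : ∀ d ds → countEq d (d ∷ ds) ≡ suc (countEq d ds)
  countEq-here d ds with d ℕ.≟ d
  ... | yes _   = refl
  ... | no  d≢d = contradiction refl d≢d

  countEq-there : ∀ {k d} ds → k ≢ d → countEq k (d ∷ ds) ≡ countEq k ds
  countEq-there {k} {d} ds k≢d with k ℕ.≟ d
  ... | yes k≡d = contradiction k≡d k≢d
  ... | no  _   = refl

  countEq-∷ : ∀ k d ds → countEq k (d ∷ ds) ≡ countEq k (d ∷ []) ℕ.+ countEq k ds
  countEq-∷ k d ds with k ℕ.≟ d
  ... | yes _ = refl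
  ... | no  _ = refl

  ∼-∷ : ∀ d {xs ys} → xs ∼ ys → d ∷ xs ∼ d ∷ ys
  ∼-∷ d {xs} {ys} xs∼ys k =
    trans (countEq-∷ k d xs) (trans (cong (countEq k (d ∷ []) ℕ.+_) (xs∼ys k)) (sym (countEq-∷ k d ys)))

  ∼-∷-cancel : ∀ d {xs ys} → d ∷ xs ∼ d ∷ ys → xs ∼ ys
  ∼-∷-cancel d {xs} {ys} dxs∼dys k = ℕₚ.+-cancelˡ-≡ (countEq k (d ∷ [])) _ _
    (trans (sym (countEq-∷ k d xs)) (trans (dxs∼dys k) (countEq-∷ k d ys)))

  ∼-swap : ∀ a b xs → a ∷ b ∷ xs ∼ b ∷ a ∷ xs
  ∼-swap a b xs k = begin
    countEq k (a ∷ b ∷ xs)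
      ≡⟨ trans (countEq-∷ k a _) (cong (δa ℕ.+_) (countEq-∷ k b xs)) ⟩
    δa ℕ.+ (δb ℕ.+ countEq k xs)
      ≡⟨ solve 3 (λ x y z → x :+ (y :+ z) := y :+ (x :+ z)) refl δa δb (countEq k xs) ⟩
    δb ℕ.+ (δa ℕ.+ countEq k xs)
      ≡⟨ trans (countEq-∷ k b _) (cong (δb ℕ.+_) (countEq-∷ k a xs)) ⟨
    countEq k (b ∷ a ∷ xs)
      ∎
    where
      open ≡-Reasoning
      δa : ℕ
      δa = countEq k (a ∷ [])
      δb : ℕ
      δb = countEq k (b ∷ [])

  []∼⇒≡[] : ∀ {ys} → [] ∼ ys → ys ≡ []
  []∼⇒≡[] {[]}     _    = refl
  []∼⇒≡[] {y ∷ ys} []∼ with () ← trans ([]∼ y) (countEq-here y ys)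

  -- The number of ways to pick, for each entry d of the list in turn, one of the
  -- remaining entries equal to d, and one of two polynomials.
  fibreSize : List ℕ → ℕ
  fibreSize []       = 1
  fibreSize (d ∷ ds) = countEq d (d ∷ ds) * (2 * fibreSize ds)

  factorials : List ℕ → List ℕ → ℕ
  factorials ds ks = product (map (λ k → countEq k ds !) ks)

  factorials-[] : ∀ ks → factorials [] ks ≡ 1
  factorials-[] []       = refl
  factorials-[] (k ∷ ks) = trans (ℕₚ.+-identityʳ _) (factorials-[] ks)

  factorials-∉ : ∀ {d} ds ks → All (_≢ d) ks → factorials (d ∷ ds) ks ≡ factorials ds ks
  factorials-∉ ds []       []             = refl
  factorials-∉ ds (k ∷ ks) (k≢d ∷ ks≢d) =
    cong₂ _*_ (cong _! (countEq-there ds k≢d)) (factorials-∉ ds ks ks≢d)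

  factorials-∷ : ∀ d ds {ks} → Unique ks → d ∈ ks → factorials (d ∷ ds) ks ≡ countEq d (d ∷ ds) * factorials ds ks
  factorials-∷ d ds {.d ∷ ks} (d∉ks ∷ _) (here refl) = begin
    countEq d (d ∷ ds) ! * factorials (d ∷ ds) ks
      ≡⟨ cong₂ _*_ (cong _! (countEq-here d ds))
                                                                       (factorials-∉ ds ks (All.map (λ d≢k k≡d → d≢k (sym k≡d)) d∉ks)) ⟩
    suc c * c ! * factorials ds ks
      ≡⟨ ℕₚ.*-assoc (suc c) (c !) _ ⟩
    suc c * (c ! * factorials ds ks)
      ≡⟨ cong (_* (c ! * factorials ds ks)) (countEq-here d ds) ⟨
    countEq d (d ∷ ds) * factorials ds (d ∷ ks)
      ∎
    where
      open ≡-Reasoning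
      c : ℕ
      c = countEq d ds
  factorials-∷ d ds {k ∷ ks} (k∉ks ∷ ks-unique) (there d∈ks) = begin
    countEq k (d ∷ ds) ! * factorials (d ∷ ds) ks
      ≡⟨ cong₂ _*_ (cong _! (countEq-there ds k≢d)) (factorials-∷ d ds ks-unique d∈ks) ⟩
    countEq k ds ! * (cd * factorials ds ks)
      ≡⟨ solve 3 (λ x y z → x :* (y :* z) := y :* (x :* z)) refl
                                                                 (countEq k ds !) cd (factorials ds ks) ⟩
    cd * (countEq k ds ! * factorials ds ks)
      ∎
    where
      open ≡-Reasoning
      cd : ℕ
      cd = countEq d (d ∷ ds)
      k≢d : k ≢ d
      k≢d refl = All.lookup k∉ks d∈ks refl

  fibreSize≡factorials : ∀ ds {ks} → Unique ks → All (_∈ ks) ds →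
                         fibreSize ds ≡ 2 ^ length ds * factorials ds ks
  fibreSize≡factorials []       {ks} _         _                = sym (trans (ℕₚ.+-identityʳ _) (factorials-[] ks))
  fibreSize≡factorials (d ∷ ds) {ks} ks-unique (d∈ks ∷ ds⊆ks) = begin
    cd * (2 * fibreSize ds)
      ≡⟨ cong (λ n → cd * (2 * n)) (fibreSize≡factorials ds ks-unique ds⊆ks) ⟩
    cd * (2 * (2 ^ length ds * factorials ds ks))
      ≡⟨ solve 3 (λ c t f → c :* (con 2 :* (t :* f)) := con 2 :* t :* (c :* f)) refl
                                                                 cd (2 ^ length ds) (factorials ds ks) ⟩
    2 * 2 ^ length ds * (cd * factorials ds ks)
      ≡⟨ cong (2 * 2 ^ length ds *_) (factorials-∷ d ds ks-unique d∈ks) ⟨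
    2 * 2 ^ length ds * factorials (d ∷ ds) ks
      ∎
    where
      open ≡-Reasoning
      cd : ℕ
      cd = countEq d (d ∷ ds)

  fibreSize≡multiplicity : ∀ ds h → All (1 ≤_) ds → All (_≤ h) ds → fibreSize ds ≡ multiplicity ds h
  fibreSize≡multiplicity ds h ds≥1 ds≤h = begin
    fibreSize ds
      ≡⟨ fibreSize≡factorials ds ks-unique (All.zipWith ∈ks (ds≥1 , ds≤h)) ⟩
    2 ^ length ds * factorials ds ks
      ≡⟨ cong (λ xs → 2 ^ length ds * product xs) (Listₚ.map-∘ (upTo h)) ⟨
    multiplicity ds h
      ∎
    where
      open ≡-Reasoning
      ks : List ℕ
      ks = map suc (upTo h)
      ks-unique : Unique ks
      ks-unique = Uniqueₚ.map⁺ ℕₚ.suc-injective (Uniqueₚ.upTo⁺ h)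
      ∈ks : ∀ {d} → 1 ≤ d × d ≤ h → d ∈ ks
      ∈ks (s≤s _ , d≤h) = ∈-map⁺ suc (∈-upTo⁺ d≤h)

  ≤-sum : ∀ ds → All (_≤ sum ds) ds
  ≤-sum []       = []
  ≤-sum (d ∷ ds) = ℕₚ.m≤m+n d (sum ds) ∷ All.map (λ d′≤ → ℕₚ.≤-trans d′≤ (ℕₚ.m≤n+m (sum ds) d)) (≤-sum ds)

module Fibre (F : FiniteField) (λ₀ : FiniteField.Carrier F) (λ₀≢0 : λ₀ ≢ FiniteField.0# F) where
  open FiniteField F
  open Poly F
  open Reciprocal F λ₀ λ₀≢0 public
  open DegreeCounts public
  open PolynomialSolver using (solve; _:=_; _:*_)

  Admissible : Pol → Set
  Admissible p = Irreducible p × coeff p 0 ≢ 0#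

  AllAdmissible : ∀ {es} → Tuple es → Set
  AllAdmissible t = All Admissible (polys t)

  pairProduct : ∀ {d} → Vec Carrier d → Pol
  pairProduct {d} v = monic v *ₚ recip λ₀ d (monic v)

  H-∷ : ∀ {d ds} (v : Vec Carrier d) (vs : Tuple ds) → H λ₀ (v ∷ vs) ≃ pairProduct v *ₚ H λ₀ vs
  H-∷ {d} v vs = solve 4 (λ p ps r rs → (p :* ps) :* (r :* rs) := (p :* r) :* (ps :* rs)) ≃-refl
                         (monic v) (prodₚ (polys vs)) (recip λ₀ d (monic v)) (prodₚ (recips λ₀ vs))

  H-[] : H λ₀ [] ≃ oneₚ
  H-[] = *ₚ-identityˡ oneₚ

  recipVec : ∀ {d} → Vec Carrier d → Vec Carrier d
  recipVec {d} v = coeffVec d (recip λ₀ d (monic v))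

  alternatives : ∀ {d} → Vec Carrier d → List (Vec Carrier d)
  alternatives v = v ∷ recipVec v ∷ []

  monic-reversible : ∀ {d} (v : Vec Carrier d) → coeff (monic v) 0 ≢ 0# → Reversible (monic v) d
  monic-reversible v v₀≢0 = monic-isMonic v , v₀≢0

  monic-recipVec : ∀ {d} (v : Vec Carrier d) → coeff (monic v) 0 ≢ 0# → monic (recipVec v) ≃ recip λ₀ d (monic v)
  monic-recipVec {d} v v₀≢0 = monic-coeffVec d (proj₁ (recip-reversible (monic-reversible v v₀≢0)))

  recipVec₀≢0 : ∀ {d} (v : Vec Carrier d) → coeff (monic v) 0 ≢ 0# → coeff (monic (recipVec v)) 0 ≢ 0#
  recipVec₀≢0 v v₀≢0 ṽ₀≡0 =
    proj₂ (recip-reversible (monic-reversible v v₀≢0)) (trans (sym (coeff-≡ (monic-recipVec v v₀≢0) 0)) ṽ₀≡0)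

  recip-monic-recipVec : ∀ {d} (v : Vec Carrier d) → coeff (monic v) 0 ≢ 0# → recip λ₀ d (monic (recipVec v)) ≃ monic v
  recip-monic-recipVec {d} v v₀≢0 =
    ≃-trans (recip-cong d (monic-recipVec v v₀≢0)) (recip-involutive (monic-reversible v v₀≢0))

  pairProduct-recipVec : ∀ {d} (v : Vec Carrier d) → coeff (monic v) 0 ≢ 0# → pairProduct (recipVec v) ≃ pairProduct v
  pairProduct-recipVec v v₀≢0 =
    ≃-trans (*ₚ-cong (monic-recipVec v v₀≢0) (recip-monic-recipVec v v₀≢0)) (*ₚ-comm _ (monic v))

  admissible-recipVec : ∀ {d} (v : Vec Carrier d) → Admissible (monic v) → Admissible (monic (recipVec v))
  admissible-recipVec v (v-irr , v₀≢0) =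
    Irreducible-resp-≃ (≃-sym (monic-recipVec v v₀≢0)) (recip-irreducible (monic-reversible v v₀≢0) v-irr) ,
    recipVec₀≢0 v v₀≢0

  alternatives-pairProduct : ∀ {d} {u v : Vec Carrier d} → coeff (monic v) 0 ≢ 0# → u ∈ alternatives v →
                             pairProduct u ≃ pairProduct v
  alternatives-pairProduct         v₀≢0 (here refl)         = ≃-refl
  alternatives-pairProduct {v = v} v₀≢0 (there (here refl)) = pairProduct-recipVec v v₀≢0

  alternatives-admissible : ∀ {d} {u v : Vec Carrier d} → Admissible (monic v) → u ∈ alternatives v →
                            Admissible (monic u)
  alternatives-admissible         v-adm (here refl)         = v-adm
  alternatives-admissible {v = v} v-adm (there (here refl)) = admissible-recipVec v v-adm

  monic∣pairProduct : ∀ {d} (v : Vec Carrier d) → monic v ∣ pairProduct v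
  monic∣pairProduct {d} v = x∣xy (monic v) (recip λ₀ d (monic v))

  monic∣H : ∀ {d ds} (v : Vec Carrier d) (vs : Tuple ds) → monic v ∣ H λ₀ (v ∷ vs)
  monic∣H {d} v vs = xy≈z⇒x∣z (monic v) (recip λ₀ d (monic v) *ₚ H λ₀ vs)
    (≃-trans (≃-sym (*ₚ-assoc (monic v) _ _)) (≃-sym (H-∷ v vs)))

  pairProduct≄[] : ∀ {d} (v : Vec Carrier d) → coeff (monic v) 0 ≢ 0# → ¬ pairProduct v ≃ []
  pairProduct≄[] v v₀≢0 = *ₚ-≄[] (hasDegree⇒≄[] (isMonic⇒hasDegree (monic-isMonic v)))
    (hasDegree⇒≄[] (isMonic⇒hasDegree (proj₁ (recip-reversible (monic-reversible v v₀≢0)))))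

  monic-≃⇒degree-≡ : ∀ {d e} (u : Vec Carrier d) (v : Vec Carrier e) → monic u ≃ monic v → d ≡ e
  monic-≃⇒degree-≡ u v u≃v = hasDegree-unique (isMonic⇒hasDegree (monic-isMonic u))
    (HasDegree-resp-≃ (≃-sym u≃v) (isMonic⇒hasDegree (monic-isMonic v)))

  record Removal (d : ℕ) {es} (t : Tuple es) : Set where
    field
      restDegrees      : List ℕ
      chosen           : Vec Carrier d
      rest             : Tuple restDegrees
      degrees-split    : es ∼ d ∷ restDegrees
      H-split          : H λ₀ t ≃ pairProduct chosen *ₚ H λ₀ rest
      admissible-split : AllAdmissible t → Admissible (monic chosen) × AllAdmissible rest
  open Removal public

  removeHead : ∀ {d es} (v : Vec Carrier d) (vs : Tuple es) → Removal d (v ∷ vs)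
  removeHead v vs = record
    { restDegrees      = _
    ; chosen           = v
    ; rest             = vs
    ; degrees-split    = λ _ → refl
    ; H-split          = H-∷ v vs
    ; admissible-split = λ where (v-adm ∷ vs-adm) → v-adm , vs-adm
    }

  keepHead : ∀ {d e es} (v : Vec Carrier e) {vs : Tuple es} → Removal d vs → Removal d (v ∷ vs)
  keepHead {d} {e} v {vs} x = record
    { restDegrees      = e ∷ restDegrees x
    ; chosen           = chosen x
    ; rest             = v ∷ rest x
    ; degrees-split    = λ k → trans (∼-∷ e (degrees-split x) k) (∼-swap e d (restDegrees x) k)
    ; H-split          = begin
        H λ₀ (v ∷ vs)
          ≈⟨ H-∷ v vs ⟩
        pairProduct v *ₚ H λ₀ vs
          ≈⟨ *ₚ-cong (≃-refl {pairProduct v}) (H-split x) ⟩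
        pairProduct v *ₚ (pairProduct (chosen x) *ₚ H λ₀ (rest x))
          ≈⟨ solve 3 (λ p q r → p :* (q :* r) := q :* (p :* r)) ≃-refl
                   (pairProduct v) (pairProduct (chosen x)) (H λ₀ (rest x)) ⟩
        pairProduct (chosen x) *ₚ (pairProduct v *ₚ H λ₀ (rest x))
          ≈⟨ *ₚ-cong (≃-refl {pairProduct (chosen x)}) (H-∷ v (rest x)) ⟨
        pairProduct (chosen x) *ₚ H λ₀ (v ∷ rest x)
          ∎
    ; admissible-split = λ where
        (v-adm ∷ vs-adm) → proj₁ (admissible-split x vs-adm) , v-adm ∷ proj₂ (admissible-split x vs-adm)
    }
    where open ≃-Reasoning

  removals : ∀ d {es} (t : Tuple es) → List (Removal d t)
  removals d {[]}     []       = []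
  removals d {e ∷ es} (v ∷ vs) with d ℕ.≟ e
  ... | yes refl = removeHead v vs ∷ map (keepHead v) (removals d vs)
  ... | no  _    = map (keepHead v) (removals d vs)

  length-removals : ∀ d {es} (t : Tuple es) → length (removals d t) ≡ countEq d es
  length-removals d {[]}     []       = refl
  length-removals d {e ∷ es} (v ∷ vs) with d ℕ.≟ e
  ... | yes refl = cong suc (trans (Listₚ.length-map (keepHead v) (removals d vs)) (length-removals d vs))
  ... | no  _    = trans (Listₚ.length-map (keepHead v) (removals d vs)) (length-removals d vs)

  PairDivides : ∀ {d es} (t : Tuple es) → Removal d t → Removal d t → Set
  PairDivides t x y = pairProduct (chosen x) *ₚ pairProduct (chosen y) ∣ H λ₀ t

  keepHead-pairwise : ∀ {d e es} (v : Vec Carrier e) {vs : Tuple es} {xs : List (Removal d vs)} →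
                      AllPairs (PairDivides vs) xs → AllPairs (PairDivides (v ∷ vs)) (map (keepHead v) xs)
  keepHead-pairwise v {vs} = AllPairsₚ.map⁺ ∘ AllPairs.map λ xy∣H →
    ∣ʳ-respʳ-≈ (≃-sym (H-∷ v vs)) (x∣ʳy⇒x∣ʳzy (pairProduct v) xy∣H)

  removals-pairwise : ∀ d {es} (t : Tuple es) → AllPairs (PairDivides t) (removals d t)
  removals-pairwise d {[]}     []       = []
  removals-pairwise d {e ∷ es} (v ∷ vs) with d ℕ.≟ e
  ... | yes refl = Allₚ.map⁺ (All.universal head∣H (removals d vs)) ∷ keepHead-pairwise v (removals-pairwise d vs)
    where
      head∣H : ∀ y → PairDivides (v ∷ vs) (removeHead v vs) (keepHead v y)
      head∣H y = H λ₀ (rest y) , (begin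
        H λ₀ (rest y) *ₚ (pairProduct v *ₚ pairProduct (chosen y))
          ≈⟨ solve 3 (λ r p q → r :* (p :* q) := p :* (q :* r)) ≃-refl
                   (H λ₀ (rest y)) (pairProduct v) (pairProduct (chosen y)) ⟩
        pairProduct v *ₚ (pairProduct (chosen y) *ₚ H λ₀ (rest y))
          ≈⟨ *ₚ-cong (≃-refl {pairProduct v}) (H-split y) ⟨
        pairProduct v *ₚ H λ₀ vs
          ≈⟨ H-∷ v vs ⟨
        H λ₀ (v ∷ vs)
          ∎)
        where open ≃-Reasoning
  ... | no  _    = keepHead-pairwise v (removals-pairwise d vs)

  Offers : ∀ {d es} {t : Tuple es} → Vec Carrier d → Removal d t → Set
  Offers u x = u ∈ alternatives (chosen x)

  removals-here : ∀ {d es} (v : Vec Carrier d) (vs : Tuple es) {u : Vec Carrier d} →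
                  u ∈ alternatives v → Any (Offers u) (removals d (v ∷ vs))
  removals-here {d} v vs u∈ with d ℕ.≟ d
  ... | yes refl = here u∈
  ... | no  d≢d  = contradiction refl d≢d

  removals-there : ∀ {d e es} (v : Vec Carrier e) (vs : Tuple es) {u : Vec Carrier d} →
                   Any (Offers u) (removals d vs) → Any (Offers u) (removals d (v ∷ vs))
  removals-there {d} {e} v vs offered with d ℕ.≟ e
  ... | yes refl = there (Anyₚ.map⁺ offered)
  ... | no  _    = Anyₚ.map⁺ offered

  offered-by-head : ∀ {d e es} (u : Vec Carrier d) (v : Vec Carrier e) (vs : Tuple es) {w : Vec Carrier e} →
                    w ∈ alternatives v → monic u ≃ monic w → Any (Offers u) (removals d (v ∷ vs))
  offered-by-head u v vs {w} w∈ u≃w with monic-≃⇒degree-≡ u w u≃w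
  ... | refl with monic-injective u≃w
  ...   | refl = removals-here v vs w∈

  removals-head-offer : ∀ {d e es} (u : Vec Carrier d) (v : Vec Carrier e) (vs : Tuple es) →
                        Irreducible (monic u) → Admissible (monic v) → monic u ∣ pairProduct v →
                        Any (Offers u) (removals d (v ∷ vs))
  removals-head-offer u v vs u-irr v-adm@(v-irr , v₀≢0) u∣vṽ with Prime.split-∣ (irreducible⇒prime u-irr) u∣vṽ
  ... | inj₁ u∣v = offered-by-head u v vs (here refl)
    (irreducible-monic-∣⇒≃ v-irr u-irr (monic-isMonic v) (monic-isMonic u) u∣v)
  ... | inj₂ u∣ṽ = offered-by-head u v vs (there (here refl))
    (irreducible-monic-∣⇒≃ (proj₁ (admissible-recipVec v v-adm)) u-irr (monic-isMonic (recipVec v)) (monic-isMonic u)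
                           (∣ʳ-respʳ-≈ (≃-sym (monic-recipVec v v₀≢0)) u∣ṽ))

  removals-offer : ∀ {d es} (u : Vec Carrier d) (t : Tuple es) → Irreducible (monic u) → AllAdmissible t →
                   monic u ∣ H λ₀ t → Any (Offers u) (removals d t)
  removals-offer u [] u-irr [] u∣H =
    contradiction (∣ʳ-respʳ-≈ H-[] u∣H) (Prime.p∤1 (irreducible⇒prime u-irr))
  removals-offer u (v ∷ vs) u-irr (v-adm ∷ vs-adm) u∣H
    with Prime.split-∣ (irreducible⇒prime u-irr) (∣ʳ-respʳ-≈ (H-∷ v vs) u∣H)
  ... | inj₁ u∣vṽ = removals-head-offer u v vs u-irr v-adm u∣vṽ
  ... | inj₂ u∣Hvs = removals-there v vs (removals-offer u vs u-irr vs-adm u∣Hvs)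

  chosen-admissible : ∀ {d es} {t : Tuple es} → AllAdmissible t → (x : Removal d t) → Admissible (monic (chosen x))
  chosen-admissible t-adm x = proj₁ (admissible-split x t-adm)

  rest-inI : ∀ {d es} {t : Tuple es} (x : Removal d t) → InI λ₀ t → InI λ₀ (rest x)
  rest-inI x (t-adm , H-sep) =
    proj₂ (admissible-split x t-adm) ,
    separable-*ₚʳ (pairProduct (chosen x)) (H λ₀ (rest x)) (Separable-resp-≃ (H-split x) H-sep)

  rest-∼ : ∀ {d ds es} {t : Tuple es} (x : Removal d t) → d ∷ ds ∼ es → ds ∼ restDegrees x
  rest-∼ {d} x ds∼es = ∼-∷-cancel d λ k → trans (ds∼es k) (degrees-split x k)

  -- The tuples of degrees ds whose entries are the entries of t (each used once, degrees
  -- matching), each possibly replaced by its reciprocal.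
  candidates : ∀ ds {es} → Tuple es → List (Tuple ds)
  extensions : ∀ {d} ds {es} {t : Tuple es} → Removal d t → List (Tuple (d ∷ ds))

  candidates []       _ = [] ∷ []
  candidates (d ∷ ds) t = concatMap (extensions ds) (removals d t)

  extensions ds x = cartesianProductWith _∷_ (alternatives (chosen x)) (candidates ds (rest x))

  length-candidates : ∀ ds {es} (t : Tuple es) → ds ∼ es → length (candidates ds t) ≡ fibreSize ds
  length-candidates []       t _     = refl
  length-candidates (d ∷ ds) t ds∼es = begin
    length (concatMap (extensions ds) (removals d t))
      ≡⟨ length-concatMap (extensions ds) (removals d t)
                                                              (All.universal length-extensions (removals d t)) ⟩
    length (removals d t) ℕ.* (2 ℕ.* fibreSize ds)
      ≡⟨ cong (ℕ._* (2 ℕ.* fibreSize ds)) (trans (length-removals d t) (sym (ds∼es d))) ⟩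
    countEq d (d ∷ ds) ℕ.* (2 ℕ.* fibreSize ds)
      ∎
    where
      open ≡-Reasoning
      length-extensions : ∀ x → length (extensions ds x) ≡ 2 ℕ.* fibreSize ds
      length-extensions x = trans (length-cartesianProductWith _∷_ (alternatives (chosen x)) (candidates ds (rest x)))
                                  (cong (2 ℕ.*_) (length-candidates ds (rest x) (rest-∼ x ds∼es)))

  candidates-sound : ∀ ds {es} (t : Tuple es) → InI λ₀ t → ds ∼ es →
                     ∀ {Q} → Q ∈ candidates ds t → InI λ₀ Q × H λ₀ Q ≃ H λ₀ t
  candidates-sound []       {es} t t-I []∼es (here refl) with []∼⇒≡[] {es} []∼es | t
  ... | refl | [] = t-I , ≃-refl
  candidates-sound (d ∷ ds) t t-I@(t-adm , H-sep) ds∼es Q∈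
    with Any.satisfied (∈-concatMap⁻ (extensions ds) {xs = removals d t} Q∈)
  ... | x , Q∈ext with ∈-cartesianProductWith⁻ _∷_ (alternatives (chosen x)) (candidates ds (rest x)) Q∈ext
  ...   | h , Q′ , h∈ , Q′∈ , refl = (h-adm ∷ Q′-adm , Separable-resp-≃ (≃-sym HQ≃Ht) H-sep) , HQ≃Ht
    where
      h-adm : Admissible (monic h)
      h-adm = alternatives-admissible (chosen-admissible t-adm x) h∈
      IH : InI λ₀ Q′ × H λ₀ Q′ ≃ H λ₀ (rest x)
      IH = candidates-sound ds (rest x) (rest-inI x t-I) (rest-∼ x ds∼es) Q′∈
      Q′-adm : AllAdmissible Q′
      Q′-adm = proj₁ (proj₁ IH)
      HQ≃Ht : H λ₀ (h ∷ Q′) ≃ H λ₀ t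
      HQ≃Ht = begin
        H λ₀ (h ∷ Q′)
          ≈⟨ H-∷ h Q′ ⟩
        pairProduct h *ₚ H λ₀ Q′
          ≈⟨ *ₚ-cong (alternatives-pairProduct (proj₂ (chosen-admissible t-adm x)) h∈) (proj₂ IH) ⟩
        pairProduct (chosen x) *ₚ H λ₀ (rest x)
          ≈⟨ H-split x ⟨
        H λ₀ t
          ∎
        where open ≃-Reasoning

  candidates-complete : ∀ ds {es} (t : Tuple es) → InI λ₀ t → ds ∼ es →
                        ∀ Q → InI λ₀ Q → H λ₀ Q ≃ H λ₀ t → Q ∈ candidates ds t
  candidates-complete []       t _   _     [] _ _ = here refl
  candidates-complete (d ∷ ds) t t-I@(t-adm , _) ds∼es (u ∷ Q′) (u-adm ∷ Q′-adm , HQ-sep) HQ≃Ht =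
    ∈-concatMap⁺ (extensions ds) {xs = removals d t}
                 (Any.map (λ {x} → extend {x}) (removals-offer u t (proj₁ u-adm) t-adm u∣Ht))
    where
      u∣Ht : monic u ∣ H λ₀ t
      u∣Ht = ∣ʳ-respʳ-≈ HQ≃Ht (monic∣H u Q′)
      Q′-I : InI λ₀ Q′
      Q′-I = Q′-adm , separable-*ₚʳ (pairProduct u) (H λ₀ Q′) (Separable-resp-≃ (H-∷ u Q′) HQ-sep)
      extend : ∀ {x} → Offers u x → u ∷ Q′ ∈ extensions ds x
      extend {x} u∈ = ∈-cartesianProductWith⁺ _∷_ u∈
        (candidates-complete ds (rest x) (rest-inI x t-I) (rest-∼ x ds∼es) Q′ Q′-I HQ′≃)
        where
          x₀≢0 : coeff (monic (chosen x)) 0 ≢ 0#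
          x₀≢0 = proj₂ (chosen-admissible t-adm x)
          HQ′≃ : H λ₀ Q′ ≃ H λ₀ (rest x)
          HQ′≃ = *ₚ-cancelˡ (pairProduct≄[] u (proj₂ u-adm)) (begin
            pairProduct u *ₚ H λ₀ Q′
              ≈⟨ H-∷ u Q′ ⟨
            H λ₀ (u ∷ Q′)
              ≈⟨ HQ≃Ht ⟩
            H λ₀ t
              ≈⟨ H-split x ⟩
            pairProduct (chosen x) *ₚ H λ₀ (rest x)
              ≈⟨ *ₚ-cong (alternatives-pairProduct x₀≢0 u∈) (≃-refl {H λ₀ (rest x)}) ⟨
            pairProduct u *ₚ H λ₀ (rest x)
              ∎)
            where open ≃-Reasoning

  pairProduct∣H : ∀ {d es} {t : Tuple es} (x : Removal d t) → pairProduct (chosen x) ∣ H λ₀ t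
  pairProduct∣H x = xy≈z⇒x∣z (pairProduct (chosen x)) _ (≃-sym (H-split x))

  candidates-unique : ∀ ds {es} (t : Tuple es) → InI λ₀ t → Unique (candidates ds t)
  candidates-unique []       t _ = [] ∷ []
  candidates-unique (d ∷ ds) t t-I@(t-adm , H-sep) =
    Uniqueₚ.concat⁺ (Allₚ.map⁺ (All.universal extensions-unique (removals d t)))
                    (AllPairsₚ.map⁺ (AllPairs.map (λ {x} {y} → extensions-disjoint x y) (removals-pairwise d t)))
    where
      chosen≢recipVec : ∀ (x : Removal d t) → chosen x ≢ recipVec (chosen x)
      chosen≢recipVec x c≡c̃ =
        proj₁ c-irr (separable⇒squarefree (monic c) H-sep (∣ʳ-trans c²∣cc̃ (pairProduct∣H x)))
        where
          c : Vec Carrier d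
          c = chosen x
          c-irr : Irreducible (monic c)
          c-irr = proj₁ (chosen-admissible t-adm x)
          c²∣cc̃ : monic c *ₚ monic c ∣ pairProduct c
          c²∣cc̃ = ∣ʳ-reflexive (*ₚ-cong (≃-refl {monic c})
            (≃-trans (≃-reflexive (cong monic c≡c̃)) (monic-recipVec c (proj₂ (chosen-admissible t-adm x)))))

      extensions-unique : ∀ x → Unique (extensions ds x)
      extensions-unique x = Uniqueₚ.cartesianProductWith⁺ _∷_ (λ where refl → refl , refl)
        ((chosen≢recipVec x ∷ []) ∷ [] ∷ []) (candidates-unique ds (rest x) (rest-inI x t-I))

      extensions-disjoint : ∀ x y → PairDivides t x y → Disjoint (extensions ds x) (extensions ds y)
      extensions-disjoint x y xy∣H (Q∈x , Q∈y)
        with ∈-cartesianProductWith⁻ _∷_ (alternatives (chosen x)) (candidates ds (rest x)) Q∈x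
           | ∈-cartesianProductWith⁻ _∷_ (alternatives (chosen y)) (candidates ds (rest y)) Q∈y
      ... | h , _ , h∈x , _ , refl | .h , _ , h∈y , _ , refl =
        proj₁ (proj₁ (alternatives-admissible (chosen-admissible t-adm x) h∈x))
          (separable⇒squarefree (monic h) H-sep (∣ʳ-trans h²∣hh̃hh̃ hh̃hh̃∣H))
        where
          hh̃≃ : ∀ z → h ∈ alternatives (chosen z) → pairProduct h ≃ pairProduct (chosen z)
          hh̃≃ z = alternatives-pairProduct (proj₂ (chosen-admissible t-adm z))
          h²∣hh̃hh̃ : monic h *ₚ monic h ∣ pairProduct h *ₚ pairProduct h
          h²∣hh̃hh̃ = ∙-cong-∣ (monic∣pairProduct h) (monic∣pairProduct h)
          hh̃hh̃∣H : pairProduct h *ₚ pairProduct h ∣ H λ₀ t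
          hh̃hh̃∣H = ∣ʳ-respˡ-≈ (*ₚ-cong (≃-sym (hh̃≃ x h∈x)) (≃-sym (hh̃≃ y h∈y))) xy∣H

lemma3p10 : (F : FiniteField) → (λ₀ : FiniteField.Carrier F) → ¬ (λ₀ ≡ FiniteField.0# F) →
    (ds : List ℕ) → (h : ℕ) → IsSortedPartition ds h →
    (χ : Poly.Pol F) →
    Σ (Poly.Tuple F ds) (λ t → Poly.InI F λ₀ t × Poly._≈ₚ_ F (Poly.H F λ₀ t) χ) →
    HasSize (λ (t : Poly.Tuple F ds) → Poly.InI F λ₀ t × Poly._≈ₚ_ F (Poly.H F λ₀ t) χ)
      (multiplicity ds h)
lemma3p10 F λ₀ λ₀≢0 ds h (ds≥1 , _ , sum≡h) χ (t , t-I , Ht≈χ) =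
  candidates ds t , candidates-unique ds t t-I , size , λ Q → mk⇔ (sound Q) (complete Q)
  where
    open Poly F
    open Fibre F λ₀ λ₀≢0
    Ht≃χ : H λ₀ t ≃ χ
    Ht≃χ = mk≃ Ht≈χ

    size : length (candidates ds t) ≡ multiplicity ds h
    size = trans (length-candidates ds t (λ _ → refl))
                 (fibreSize≡multiplicity ds h ds≥1 (subst (λ n → All (_≤ n) ds) sum≡h (≤-sum ds)))

    sound : ∀ Q → Q ∈ candidates ds t → InI λ₀ Q × H λ₀ Q ≈ₚ χ
    sound Q Q∈ with candidates-sound ds t t-I (λ _ → refl) Q∈
    ... | Q-I , HQ≃Ht = Q-I , coeff-≡ (≃-trans HQ≃Ht Ht≃χ)

    complete : ∀ Q → InI λ₀ Q × H λ₀ Q ≈ₚ χ → Q ∈ candidates ds t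
    complete Q (Q-I , HQ≈χ) =
      candidates-complete ds t t-I (λ _ → refl) Q Q-I (≃-trans (mk≃ {H λ₀ Q} HQ≈χ) (≃-sym Ht≃χ))
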